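{- Let $N\geq1$ and let $\delta=\sum_{d\mid N}n_d[d]$ be a formal integer combination of positive divisors of $N$ with $\sum_{d\mid N}n_d=0$ and $\sum_{d\mid N}n_d\,d=0$. Put $D^\delta(x)=\sum_{d\mid N}n_d D(dx)$ for $x\in\mathbf{Q}$. Then the map $\Psi_\delta:\Gamma_0(N)\to\mathbf{C}$ given by $$\Psi_\delta\begin{pmatrix} a & * \\ Nc & *\end{pmatrix}=\begin{cases}0 & \text{if } c=0,\\ \mathrm{sign}(c)\cdot D^\delta\Big(\dfrac{a}{N|c|}\Big) & \text{if } c\neq 0\end{cases}$$ is a group homomorphism.
   Context: $\varepsilon(x)=\frac{1}{2i}\cot(\pi x)$. $\Gamma_0(N)=\{\left(\begin{smallmatrix}a&b\\c&d\end{smallmatrix}\right)\in\mathrm{SL}_2(\mathbf{Z}): c\equiv0\bmod N\}$. $D:\mathbf{Q}\to\mathbf{Q}$ is the Dedekind sum: for $x=a/c$ written in lowest terms with $c>0$ and $\gcd(a,c)=1$, $D(a/c)=\frac1c\sum_{j=1}^{c-1}\varepsilon(j/c)\,\varepsilon(-ja/c)$. -}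

module Defs where

open import Data.Nat as ℕ using (ℕ; zero; suc)
open import Data.Nat.Divisibility using (_∣?_)
open import Data.Integer as ℤ using (ℤ; +_; -[1+_]; +[1+_]; ∣_∣)
open import Data.Integer.Divisibility as ℤD using ()
open import Data.Rational as ℚ using (ℚ; mkℚ; 0ℚ)
open import Data.List using (List; map; filter; foldr; upTo)
open import Relation.Binary.PropositionalEquality using (_≡_)

sumℚ : List ℚ → ℚ
sumℚ = foldr ℚ._+_ 0ℚ

sumℤ : List ℤ → ℤ
sumℤ = foldr ℤ._+_ (+ 0)

saw : ℤ → (c : ℕ) → .{{_ : ℕ.NonZero c}} → ℚ
saw n c with n ℤ.%ℕ c
... | zero  = 0ℚ
... | suc r = ((+ suc r) ℚ./ c) ℚ.- ℚ.½

-- For x = a/c in lowest terms, c > 0,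
--   D(a/c) = (1/c) Σ_{j=1}^{c-1} ε(j/c) ε(-ja/c),  ε(x) = cot(πx)/(2i).
-- Since ε(j/c)ε(-ja/c) = (1/4) cot(πj/c) cot(πja/c) and
-- Σ_{j=1}^{c-1} cot(πj/c) cot(πja/c) = 4c·s(a,c), this is the classical
-- Dedekind sum s(a,c) = Σ_{j=1}^{c-1} ((j/c)) ((ja/c)),
-- which is what we compute (no trigonometry is available).

D : ℚ → ℚ
D (mkℚ a k _) = sumℚ (map term (map suc (upTo k)))   -- j = 1 .. c-1, c = k+1
  where
  term : ℕ → ℚ
  term j = saw (+ j) (suc k) ℚ.* saw (+ j ℤ.* a) (suc k)

divisors : ℕ → List ℕ
divisors N = filter (_∣? N) (map suc (upTo N))

-- δ = Σ_{d ∣ N} n_d [d], encoded by the coefficient function n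
-- (only its values on divisors of N matter).

Dδ : (N : ℕ) → (ℕ → ℤ) → ℚ → ℚ
Dδ N n x = sumℚ (map (λ d → (n d ℚ./ 1) ℚ.* D ((+ d ℚ./ 1) ℚ.* x)) (divisors N))

record Mat : Set where
  constructor mat
  field
    a b c d : ℤ

_⊗_ : Mat → Mat → Mat
mat a b c d ⊗ mat a' b' c' d' =
  mat (a ℤ.* a' ℤ.+ b ℤ.* c') (a ℤ.* b' ℤ.+ b ℤ.* d')
      (c ℤ.* a' ℤ.+ d ℤ.* c') (c ℤ.* b' ℤ.+ d ℤ.* d')

record InΓ₀ (N : ℕ) (γ : Mat) : Set where
  field
    det   : Mat.a γ ℤ.* Mat.d γ ℤ.- Mat.b γ ℤ.* Mat.c γ ≡ + 1
    level : (+ N) ℤD.∣ Mat.c γ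

-- Ψ_δ : writing the lower-left entry as N·c',
--   Ψ = 0 if c' = 0, else sign(c')·D^δ(a/(N|c'|)).
-- Since N·|c'| = |N c'| we write a/(N|c'|) as a / |lower-left entry|.

Ψ : (N : ℕ) → (ℕ → ℤ) → Mat → ℚ
Ψ N n (mat a _ (+ zero) _)  = 0ℚ
Ψ N n (mat a _ +[1+ m ] _)  = Dδ N n (a ℚ./ suc m)
Ψ N n (mat a _ -[1+ m ] _)  = ℚ.- Dδ N n (a ℚ./ suc m)

module Submission where

-- Rademacher's function Φ(M) = (a + d)/c − 12 sign(c) s(a, |c|) (and b/d when c = 0) satisfies
-- Φ(AB) = Φ(A) + Φ(B) − 3 sign(c_A c_B c_AB) on SL₂(ℤ). Indeed Φ(TᵗM) = Φ(M) + t, and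
-- Φ(SM) = Φ(M) − 3 sign(a c) is Dedekind reciprocity; writing A = Tᵗ S A′ with |c_A′| < |c_A|
-- (one step of the Euclidean algorithm) the relation follows by induction on |c_A|, up to an
-- identity between signs. Reciprocity is proved by expanding s(a, k) through the divisions
-- j a = r_j + q_j k: the r_j permute the residues, and ∑ q_j² is computed by counting lattice points.
--
-- For d ∣ N = e d, conjugating γ = (a, b; N c, δ) ∈ Γ₀(N) by diag(d, 1) gives γ_d = (a, d b; e c, δ)
-- in SL₂(ℤ), with Φ(γ_d) = d (a + δ)/(N c) − 12 sign(c) D(d a/(N |c|)). Since ∑ n_d d = 0 the first
-- terms cancel, so ∑ n_d Φ(γ_d) = −12 Ψ_δ(γ). The cocycle relation for the γ_d then gives additivity
-- of Ψ_δ, because its sign term does not depend on d and ∑ n_d = 0.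

open import Defs

module LinearCombination where
  open import Algebra.Bundles using (CommutativeRing)

  module _ {c ℓ} (R : CommutativeRing c ℓ) where
    open CommutativeRing R
    open import Algebra.Properties.AbelianGroup +-abelianGroup using (∙-cancelʳ)

    linear-combination : ∀ {l r p q} → p ≈ q → l + q ≈ r + p → l ≈ r
    linear-combination {l} {r} {p} {q} p≈q l+q≈r+p = ∙-cancelʳ q l r (trans l+q≈r+p (+-congˡ p≈q))

module FiniteSums where
  open import Data.Nat as ℕ using (ℕ; zero; suc; _<_; _≤_; _∸_; z<s; s<s)
  import Data.Nat.Properties as ℕP
  open import Data.Integer using (ℤ; +_; _+_; _*_; _-_)
  import Data.Integer.Properties as ℤP
  open import Data.Integer.Tactic.RingSolver using (solve-∀)
  open import Data.Fin using (Fin; toℕ; fromℕ<)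
  import Data.Fin.Properties as Finₚ
  open import Data.Fin.Permutation using (permutation)
  open import Algebra.Properties.Semiring.Sum ℤP.+-*-semiring
    using (sum; sum-cong-≗; ∑-distrib-+; ∑-comm; *-distribˡ-sum; sum-permute)
  open import Relation.Nullary using (Dec; yes; no; ¬_)
  open import Relation.Nullary.Negation using (contradiction)
  open import Relation.Binary.PropositionalEquality
  open ≡-Reasoning

  ∑< : ℕ → (ℕ → ℤ) → ℤ
  ∑< n f = sum {n} (λ i → f (toℕ i))

  infixl 10 ∑<
  syntax ∑< n (λ i → x) = ∑[ i < n ] x

  ∑-cong : ∀ n {f g : ℕ → ℤ} → (∀ {i} → i < n → f i ≡ g i) → ∑< n f ≡ ∑< n g
  ∑-cong n f≡g = sum-cong-≗ (λ i → f≡g (Finₚ.toℕ<n i))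

  ∑-+ : ∀ n (f g : ℕ → ℤ) → ∑[ i < n ] (f i + g i) ≡ ∑< n f + ∑< n g
  ∑-+ n f g = ∑-distrib-+ {n} (λ i → f (toℕ i)) (λ i → g (toℕ i))

  ∑-*ˡ : ∀ n c (f : ℕ → ℤ) → ∑[ i < n ] (c * f i) ≡ c * ∑< n f
  ∑-*ˡ n c f = sym (*-distribˡ-sum {n} c (λ i → f (toℕ i)))

  ∑-linear₂ : ∀ n α β (f g : ℕ → ℤ) → ∑[ i < n ] (α * f i + β * g i) ≡ α * ∑< n f + β * ∑< n g
  ∑-linear₂ n α β f g = trans (∑-+ n (λ i → α * f i) (λ i → β * g i)) (cong₂ _+_ (∑-*ˡ n α f) (∑-*ˡ n β g))

  ∑-linear₃ : ∀ n α β γ (f g h : ℕ → ℤ) →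
              ∑[ i < n ] (α * f i + β * g i + γ * h i) ≡ α * ∑< n f + β * ∑< n g + γ * ∑< n h
  ∑-linear₃ n α β γ f g h =
    trans (∑-+ n (λ i → α * f i + β * g i) (λ i → γ * h i)) (cong₂ _+_ (∑-linear₂ n α β f g) (∑-*ˡ n γ h))

  ∑-swap : ∀ m n (f : ℕ → ℕ → ℤ) → ∑[ i < m ] ∑[ j < n ] f i j ≡ ∑[ j < n ] ∑[ i < m ] f i j
  ∑-swap m n f = ∑-comm {m} {n} (λ i j → f (toℕ i) (toℕ j))

  ∑-zero : ∀ n {f : ℕ → ℤ} → (∀ {i} → i < n → f i ≡ + 0) → ∑< n f ≡ + 0
  ∑-zero zero    f≡0 = refl
  ∑-zero (suc n) f≡0 = cong₂ _+_ (f≡0 z<s) (∑-zero n (λ i<n → f≡0 (s<s i<n)))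

  ∑-split : ∀ m n (f : ℕ → ℤ) → ∑< (m ℕ.+ n) f ≡ ∑< m f + ∑[ i < n ] f (m ℕ.+ i)
  ∑-split zero    n f = sym (ℤP.+-identityˡ _)
  ∑-split (suc m) n f = begin
    f 0 + ∑< (m ℕ.+ n) (λ i → f (suc i))                         ≡⟨ cong (_+_ (f 0)) (∑-split m n (λ i → f (suc i))) ⟩
    f 0 + (∑< m (λ i → f (suc i)) + ∑[ i < n ] f (suc m ℕ.+ i))  ≡⟨ ℤP.+-assoc (f 0) _ _ ⟨
    f 0 + ∑< m (λ i → f (suc i)) + ∑[ i < n ] f (suc m ℕ.+ i)    ∎

  ∑-last : ∀ n (f : ℕ → ℤ) → ∑< (suc n) f ≡ ∑< n f + f n
  ∑-last n f = begin
    ∑< (suc n) f                      ≡⟨ cong (λ m → ∑< m f) (ℕP.+-comm 1 n) ⟩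
    ∑< (n ℕ.+ 1) f                    ≡⟨ ∑-split n 1 f ⟩
    ∑< n f + (f (n ℕ.+ 0) + + 0)      ≡⟨ cong (λ x → ∑< n f + x) (trans (ℤP.+-identityʳ _) (cong f (ℕP.+-identityʳ n))) ⟩
    ∑< n f + f n                      ∎

  ∑-permute : ∀ n (σ τ : ℕ → ℕ) (h : ℕ → ℤ) →
              (∀ {j} → j < n → σ j < n) → (∀ {j} → j < n → τ j < n) →
              (∀ {j} → j < n → σ (τ j) ≡ j) → (∀ {j} → j < n → τ (σ j) ≡ j) →
              ∑[ j < n ] h (σ j) ≡ ∑< n h
  ∑-permute n σ τ h σ< τ< στ τσ = begin
    ∑[ j < n ] h (σ j)
      ≡⟨ sum-permute {n} {n} (λ i → h (σ (toℕ i))) π ⟩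
    sum {n} (λ i → h (σ (toℕ (τ′ i))))
      ≡⟨ sum-cong-≗ {n} (λ i → cong h (trans (cong σ (Finₚ.toℕ-fromℕ< _)) (στ (Finₚ.toℕ<n i)))) ⟩
    ∑< n h ∎
    where
    lift : (ρ : ℕ → ℕ) → (∀ {j} → j < n → ρ j < n) → Fin n → Fin n
    lift ρ ρ< i = fromℕ< (ρ< (Finₚ.toℕ<n i))
    σ′ τ′ : Fin n → Fin n
    σ′ = lift σ σ<
    τ′ = lift τ τ<
    inverse : ∀ ρ ρ′ (ρ< : ∀ {j} → j < n → ρ j < n) (ρ′< : ∀ {j} → j < n → ρ′ j < n) →
              (∀ {j} → j < n → ρ (ρ′ j) ≡ j) → ∀ i → lift ρ ρ< (lift ρ′ ρ′< i) ≡ i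
    inverse ρ ρ′ ρ< ρ′< ρρ′ i = Finₚ.toℕ-injective
      (trans (Finₚ.toℕ-fromℕ< _) (trans (cong ρ (Finₚ.toℕ-fromℕ< _)) (ρρ′ (Finₚ.toℕ<n i))))
    π = permutation τ′ σ′ (inverse τ σ τ< σ< τσ) (inverse σ τ σ< τ< στ)

  ∑-telescope : ∀ (F f : ℕ → ℤ) → F 0 ≡ + 0 → (∀ i → F (suc i) ≡ F i + f i) → ∀ n → ∑< n f ≡ F n
  ∑-telescope F f F0≡0 step zero    = sym F0≡0
  ∑-telescope F f F0≡0 step (suc n) = begin
    ∑< (suc n) f   ≡⟨ ∑-last n f ⟩
    ∑< n f + f n   ≡⟨ cong (_+ f n) (∑-telescope F f F0≡0 step n) ⟩
    F n + f n      ≡⟨ step n ⟨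
    F (suc n)      ∎

  ∑-odd : ∀ n → ∑[ i < n ] (+ 2 * + i + + 1) ≡ + n * + n
  ∑-odd = ∑-telescope (λ n → + n * + n) _ refl (λ i → step (+ i))
    where
    step : ∀ i → (+ 1 + i) * (+ 1 + i) ≡ i * i + (+ 2 * i + + 1)
    step = solve-∀

  ∑-even : ∀ n → ∑[ i < n ] (+ 2 * + i) ≡ + n * + n - + n
  ∑-even = ∑-telescope (λ n → + n * + n - + n) _ refl (λ i → step (+ i))
    where
    step : ∀ i → (+ 1 + i) * (+ 1 + i) - (+ 1 + i) ≡ i * i - i + + 2 * i
    step = solve-∀

  ∑-square : ∀ n → ∑[ i < n ] (+ 6 * (+ i * + i)) ≡ + 2 * (+ n * + n * + n) - + 3 * (+ n * + n) + + n
  ∑-square = ∑-telescope (λ n → + 2 * (+ n * + n * + n) - + 3 * (+ n * + n) + + n) _ refl (λ i → step (+ i))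
    where
    step : ∀ i → + 2 * ((+ 1 + i) * (+ 1 + i) * (+ 1 + i)) - + 3 * ((+ 1 + i) * (+ 1 + i)) + (+ 1 + i)
               ≡ + 2 * (i * i * i) - + 3 * (i * i) + i + + 6 * (i * i)
    step = solve-∀

  𝟙 : ∀ {p} {P : Set p} → Dec P → ℤ
  𝟙 (yes _) = + 1
  𝟙 (no _)  = + 0

  𝟙-cong : ∀ {p q} {P : Set p} {Q : Set q} (p? : Dec P) (q? : Dec Q) → (P → Q) → (Q → P) → 𝟙 p? ≡ 𝟙 q?
  𝟙-cong (yes _) (yes _) _   _   = refl
  𝟙-cong (yes p) (no ¬q) p⇒q _   = contradiction (p⇒q p) ¬q
  𝟙-cong (no ¬p) (yes q) _   q⇒p = contradiction (q⇒p q) ¬p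
  𝟙-cong (no _)  (no _)  _   _   = refl

  𝟙-yes : ∀ {p} {P : Set p} (p? : Dec P) → P → 𝟙 p? ≡ + 1
  𝟙-yes (yes _) _ = refl
  𝟙-yes (no ¬p) p = contradiction p ¬p

  𝟙-no : ∀ {p} {P : Set p} (p? : Dec P) → ¬ P → 𝟙 p? ≡ + 0
  𝟙-no (yes p) ¬p = contradiction p ¬p
  𝟙-no (no _)  _  = refl

  ∑-𝟙-prefix : ∀ {m n} (f : ℕ → ℤ) → m ≤ n → ∑[ i < n ] (f i * 𝟙 (i ℕ.<? m)) ≡ ∑< m f
  ∑-𝟙-prefix {m} {n} f m≤n = begin
    ∑< n g                                     ≡⟨ cong (λ l → ∑< l g) (ℕP.m+[n∸m]≡n m≤n) ⟨
    ∑< (m ℕ.+ (n ∸ m)) g                       ≡⟨ ∑-split m (n ∸ m) g ⟩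
    ∑< m g + ∑[ i < n ∸ m ] g (m ℕ.+ i)        ≡⟨ cong₂ _+_ (∑-cong m inside) (∑-zero (n ∸ m) (λ {i} _ → outside i)) ⟩
    ∑< m f + + 0                               ≡⟨ ℤP.+-identityʳ _ ⟩
    ∑< m f                                     ∎
    where
    g : ℕ → ℤ
    g i = f i * 𝟙 (i ℕ.<? m)
    inside : ∀ {i} → i < m → g i ≡ f i
    inside {i} i<m = trans (cong (f i *_) (𝟙-yes (i ℕ.<? m) i<m)) (ℤP.*-identityʳ (f i))
    outside : ∀ i → g (m ℕ.+ i) ≡ + 0
    outside i = trans (cong (f (m ℕ.+ i) *_) (𝟙-no (m ℕ.+ i ℕ.<? m) (ℕP.m+n≮m m i))) (ℤP.*-zeroʳ (f (m ℕ.+ i)))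

  ∑-ones : ∀ n → ∑[ i < n ] (+ 1) ≡ + n
  ∑-ones zero    = refl
  ∑-ones (suc n) = cong (_+_ (+ 1)) (∑-ones n)

  ∑-𝟙-suffix : ∀ {t n} → t ≤ n → ∑[ j < n ] 𝟙 (t ℕ.≤? j) ≡ + (n ∸ t)
  ∑-𝟙-suffix {t} {n} t≤n = begin
    ∑< n g                                     ≡⟨ cong (λ l → ∑< l g) (ℕP.m+[n∸m]≡n t≤n) ⟨
    ∑< (t ℕ.+ (n ∸ t)) g                       ≡⟨ ∑-split t (n ∸ t) g ⟩
    ∑< t g + ∑[ j < n ∸ t ] g (t ℕ.+ j)        ≡⟨ cong₂ _+_ (∑-zero t before) (∑-cong (n ∸ t) (λ {j} _ → after j)) ⟩
    + 0 + ∑[ j < n ∸ t ] (+ 1)                 ≡⟨ ℤP.+-identityˡ _ ⟩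
    ∑[ j < n ∸ t ] (+ 1)                       ≡⟨ ∑-ones (n ∸ t) ⟩
    + (n ∸ t)                                  ∎
    where
    g : ℕ → ℤ
    g j = 𝟙 (t ℕ.≤? j)
    before : ∀ {j} → j < t → g j ≡ + 0
    before {j} j<t = 𝟙-no (t ℕ.≤? j) (ℕP.<⇒≱ j<t)
    after : ∀ j → g (t ℕ.+ j) ≡ + 1
    after j = 𝟙-yes (t ℕ.≤? t ℕ.+ j) (ℕP.m≤m+n t j)

  ∑-head : ∀ n .{{_ : ℕ.NonZero n}} (f : ℕ → ℤ) → ∑< n f ≡ f 0 + ∑[ i < ℕ.pred n ] f (suc i)
  ∑-head (suc n) f = refl

module Remainders where
  open import Data.Nat as ℕ using (ℕ; zero; suc; NonZero; _<_; _≤_; _%_; _/_; z<s; s<s)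
  import Data.Nat.Properties as ℕP
  open import Data.Nat.DivMod
    using (m≡m%n+[m/n]*n; m%n<n; %-distribˡ-*; m%n%n≡m%n; m<n⇒m%n≡m; [m+kn]%n≡m%n; [m+n]%n≡m%n;
           m/n*n≤m; m*n/n≡m; /-monoˡ-≤)
  open import Data.Nat.Divisibility using (_∣_; ∣⇒≤; m%n≡0⇒n∣m)
  open import Data.Nat.Coprimality using (Coprime; coprime-divisor; coprime-Bézout)
  open import Data.Nat.GCD using (module Bézout)
  import Data.Nat.Tactic.RingSolver as ℕ-Solver
  open import Data.Integer using (ℤ; +_; -[1+_]; +[1+_]; _+_; _*_; -_; _-_; _%ℕ_; _/ℕ_)
  import Data.Integer.Properties as ℤP
  open import Data.Integer.DivMod using (a≡a%ℕn+[a/ℕn]*n; n%ℕd<d)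
  open import Data.Integer.Tactic.RingSolver using (solve-∀)
  open import Data.Product using (∃; _,_)
  open import Relation.Nullary.Negation using (contradiction)
  open import Relation.Binary.PropositionalEquality
  open FiniteSums

  private
    pos-multiple : ∀ {r s k} m → + r ≡ + s + +[1+ m ] * + k → k ≤ r
    pos-multiple {r} {s} {k} m eq = begin
      k                    ≤⟨ ℕP.m≤m+n k (m ℕ.* k) ⟩
      suc m ℕ.* k          ≤⟨ ℕP.m≤n+m (suc m ℕ.* k) s ⟩
      s ℕ.+ suc m ℕ.* k
        ≡⟨ ℤP.+-injective (trans (trans (ℤP.pos-+ s _) (cong (_+_ (+ s)) (ℤP.pos-* (suc m) k))) (sym eq)) ⟩
      r ∎
      where open ℕP.≤-Reasoning

  remainders-unique : ∀ {r s k} d → r < k → s < k → + r ≡ + s + d * + k → r ≡ s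
  remainders-unique (+ zero)  _   _   eq = ℤP.+-injective (trans eq (ℤP.+-identityʳ _))
  remainders-unique +[1+ m ] r<k _   eq = contradiction (pos-multiple m eq) (ℕP.<⇒≱ r<k)
  remainders-unique {r} {s} {k} -[1+ m ] _ s<k eq = contradiction (pos-multiple m eq′) (ℕP.<⇒≱ s<k)
    where
    move : ∀ r s d → r ≡ s + (- d) → s ≡ r + d
    move r s d refl = cancel s d
      where
      cancel : ∀ s d → s ≡ s + - d + d
      cancel = solve-∀
    eq′ : + s ≡ + r + +[1+ m ] * + k
    eq′ = move (+ r) (+ s) (+[1+ m ] * + k) (trans eq (cong (_+_ (+ s)) (sym (ℤP.neg-distribˡ-* +[1+ m ] (+ k)))))

  %ℕ-unique : ∀ x k .{{_ : NonZero k}} {r} q → r < k → x ≡ + r + q * + k → x %ℕ k ≡ r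
  %ℕ-unique x k {r} q r<k x≡r+qk = sym (remainders-unique (x /ℕ k - q) r<k (n%ℕd<d x k) r≡)
    where
    rearrange : ∀ r q s p k → r + q * k ≡ s + p * k → r ≡ s + (p - q) * k
    rearrange r q s p k eq = trans (shift r q k) (trans (cong (_- q * k) eq) (regroup s p q k))
      where
      shift : ∀ r q k → r ≡ r + q * k - q * k
      shift = solve-∀
      regroup : ∀ s p q k → s + p * k - q * k ≡ s + (p - q) * k
      regroup = solve-∀
    r≡ : + r ≡ + (x %ℕ k) + (x /ℕ k - q) * + k
    r≡ = rearrange (+ r) q (+ (x %ℕ k)) (x /ℕ k) (+ k) (trans (sym x≡r+qk) (a≡a%ℕn+[a/ℕn]*n x k))

  %ℕ-periodic : ∀ x t k .{{_ : NonZero k}} → (x + t * + k) %ℕ k ≡ x %ℕ k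
  %ℕ-periodic x t k = %ℕ-unique (x + t * + k) k (x /ℕ k + t) (n%ℕd<d x k)
    (trans (cong (_+ t * + k) (a≡a%ℕn+[a/ℕn]*n x k)) (regroup (+ (x %ℕ k)) (x /ℕ k) t (+ k)))
    where
    regroup : ∀ r q t k → r + q * k + t * k ≡ r + (q + t) * k
    regroup = solve-∀

  %ℕ-neg-zero : ∀ x k .{{_ : NonZero k}} → x %ℕ k ≡ 0 → (- x) %ℕ k ≡ 0
  %ℕ-neg-zero x k x%k≡0 = %ℕ-unique (- x) k (- (x /ℕ k)) (ℕ.>-nonZero⁻¹ k) (begin
    - x                                 ≡⟨ cong -_ (a≡a%ℕn+[a/ℕn]*n x k) ⟩
    - (+ (x %ℕ k) + x /ℕ k * + k)       ≡⟨ cong (λ r → - (+ r + x /ℕ k * + k)) x%k≡0 ⟩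
    - (+ 0 + x /ℕ k * + k)              ≡⟨ negate (x /ℕ k) (+ k) ⟩
    + 0 + - (x /ℕ k) * + k              ∎)
    where
    open ≡-Reasoning
    negate : ∀ q k → - (+ 0 + q * k) ≡ + 0 + - q * k
    negate = solve-∀

  %ℕ-neg-suc : ∀ x k .{{_ : NonZero k}} {r s} → x %ℕ k ≡ suc r → k ≡ suc r ℕ.+ suc s → (- x) %ℕ k ≡ suc s
  %ℕ-neg-suc x k {r} {s} x%k≡1+r k≡ = %ℕ-unique (- x) k (- (x /ℕ k) - + 1) s<k (begin
    - x                                          ≡⟨ cong -_ (a≡a%ℕn+[a/ℕn]*n x k) ⟩
    - (+ (x %ℕ k) + x /ℕ k * + k)                ≡⟨ cong (λ r → - (+ r + x /ℕ k * + k)) x%k≡1+r ⟩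
    - (+ suc r + x /ℕ k * + k)                   ≡⟨ cong (λ K → - (+ suc r + x /ℕ k * K)) +k≡ ⟩
    - (+ suc r + x /ℕ k * (+ suc r + + suc s))   ≡⟨ negate (+ suc r) (+ suc s) (x /ℕ k) ⟩
    + suc s + (- (x /ℕ k) - + 1) * (+ suc r + + suc s) ≡⟨ cong (λ K → + suc s + (- (x /ℕ k) - + 1) * K) +k≡ ⟨
    + suc s + (- (x /ℕ k) - + 1) * + k           ∎)
    where
    open ≡-Reasoning
    +k≡ : + k ≡ + suc r + + suc s
    +k≡ = trans (cong +_ k≡) (ℤP.pos-+ (suc r) (suc s))
    s<k : suc s < k
    s<k = subst (suc s <_) (sym k≡) (ℕP.m<n+m (suc s) z<s)
    negate : ∀ r s q → - (r + q * (r + s)) ≡ s + (- q - + 1) * (r + s)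
    negate = solve-∀

  coprime⇒%≢0 : ∀ {k a j} .{{_ : NonZero k}} → Coprime k a → 0 < j → j < k → (j ℕ.* a) % k ≢ 0
  coprime⇒%≢0 {k} {a} {j} k⊥a 0<j j<k ja%k≡0 = ℕP.<⇒≱ j<k (∣⇒≤ {{ℕ.>-nonZero 0<j}} k∣j)
    where
    k∣j : k ∣ j
    k∣j = coprime-divisor k⊥a (subst (k ∣_) (ℕP.*-comm j a) (m%n≡0⇒n∣m (j ℕ.* a) k ja%k≡0))

  %-*ˡ : ∀ x y k .{{_ : NonZero k}} → ((x % k) ℕ.* y) % k ≡ (x ℕ.* y) % k
  %-*ˡ x y k = begin
    ((x % k) ℕ.* y) % k               ≡⟨ %-distribˡ-* (x % k) y k ⟩
    ((x % k % k) ℕ.* (y % k)) % k     ≡⟨ cong (λ z → (z ℕ.* (y % k)) % k) (m%n%n≡m%n x k) ⟩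
    ((x % k) ℕ.* (y % k)) % k         ≡⟨ %-distribˡ-* x y k ⟨
    (x ℕ.* y) % k                     ∎
    where open ≡-Reasoning

  %-inverse : ∀ a k .{{_ : NonZero k}} → Coprime a k → ∃ λ u → (a ℕ.* u) % k ≡ 1 % k
  %-inverse a (suc k) a⊥k with coprime-Bézout a⊥k
  ... | Bézout.+- x y 1+yk≡xa = x , (begin
    (a ℕ.* x) % suc k                    ≡⟨ cong (_% suc k) (trans (ℕP.*-comm a x) (sym 1+yk≡xa)) ⟩
    (1 ℕ.+ y ℕ.* suc k) % suc k          ≡⟨ [m+kn]%n≡m%n 1 y (suc k) ⟩
    1 % suc k                            ∎)
    where open ≡-Reasoning
  ... | Bézout.-+ x y 1+xa≡yk = k ℕ.* x , (begin
    (a ℕ.* (k ℕ.* x)) % suc k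
      ≡⟨ [m+n]%n≡m%n (a ℕ.* (k ℕ.* x)) (suc k) ⟨
    (a ℕ.* (k ℕ.* x) ℕ.+ suc k) % suc k
      ≡⟨ cong (_% suc k) (trans (expand a k x) (cong (λ z → k ℕ.* z ℕ.+ 1) 1+xa≡yk)) ⟩
    (k ℕ.* (y ℕ.* suc k) ℕ.+ 1) % suc k
      ≡⟨ cong (_% suc k) (regroup k y) ⟩
    (1 ℕ.+ (k ℕ.* y) ℕ.* suc k) % suc k
      ≡⟨ [m+kn]%n≡m%n 1 (k ℕ.* y) (suc k) ⟩
    1 % suc k ∎)
    where
    open ≡-Reasoning
    expand : ∀ a k x → a ℕ.* (k ℕ.* x) ℕ.+ suc k ≡ k ℕ.* (1 ℕ.+ x ℕ.* a) ℕ.+ 1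
    expand = ℕ-Solver.solve-∀
    regroup : ∀ k y → k ℕ.* (y ℕ.* suc k) ℕ.+ 1 ≡ 1 ℕ.+ (k ℕ.* y) ℕ.* suc k
    regroup = ℕ-Solver.solve-∀

  ∑-%-permute : ∀ a k .{{_ : NonZero k}} → Coprime a k → (h : ℕ → ℤ) → ∑[ j < k ] h ((j ℕ.* a) % k) ≡ ∑< k h
  ∑-%-permute a k a⊥k h with %-inverse a k a⊥k
  ... | u , au≡1 = ∑-permute k σ τ h (λ _ → m%n<n _ k) (λ _ → m%n<n _ k)
                     (cancel u a (trans (cong (_% k) (ℕP.*-comm u a)) au≡1)) (cancel a u au≡1)
    where
    σ τ : ℕ → ℕ
    σ j = (j ℕ.* a) % k
    τ j = (j ℕ.* u) % k
    cancel : ∀ v w → (v ℕ.* w) % k ≡ 1 % k → ∀ {j} → j < k → ((j ℕ.* v) % k ℕ.* w) % k ≡ j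
    cancel v w vw≡1 {j} j<k = begin
      ((j ℕ.* v) % k ℕ.* w) % k     ≡⟨ %-*ˡ (j ℕ.* v) w k ⟩
      (j ℕ.* v ℕ.* w) % k           ≡⟨ cong (_% k) (ℕP.*-assoc j v w) ⟩
      (j ℕ.* (v ℕ.* w)) % k         ≡⟨ cong (_% k) (ℕP.*-comm j (v ℕ.* w)) ⟩
      ((v ℕ.* w) ℕ.* j) % k         ≡⟨ %-*ˡ (v ℕ.* w) j k ⟨
      ((v ℕ.* w) % k ℕ.* j) % k     ≡⟨ cong (λ z → (z ℕ.* j) % k) vw≡1 ⟩
      (1 % k ℕ.* j) % k             ≡⟨ %-*ˡ 1 j k ⟩
      (1 ℕ.* j) % k                 ≡⟨ cong (_% k) (ℕP.*-identityˡ j) ⟩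
      j % k                         ≡⟨ m<n⇒m%n≡m j<k ⟩
      j                             ∎
      where open ≡-Reasoning

  m≤n/o⇒m*o≤n : ∀ m n o .{{_ : NonZero o}} → m ≤ n / o → m ℕ.* o ≤ n
  m≤n/o⇒m*o≤n m n o m≤n/o = ℕP.≤-trans (ℕP.*-monoˡ-≤ o m≤n/o) (m/n*n≤m n o)

  m*o≤n⇒m≤n/o : ∀ m n o .{{_ : NonZero o}} → m ℕ.* o ≤ n → m ≤ n / o
  m*o≤n⇒m≤n/o m n o m*o≤n = subst (_≤ n / o) (m*n/n≡m m o) (/-monoˡ-≤ o m*o≤n)

  m<[1+m/n]*n : ∀ m n .{{_ : NonZero n}} → m < suc (m / n) ℕ.* n
  m<[1+m/n]*n m n = subst (_< suc (m / n) ℕ.* n) (sym (m≡m%n+[m/n]*n m n)) (ℕP.+-monoˡ-< ((m / n) ℕ.* n) (m%n<n m n))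

  m%n≢0⇒[m/n]*n<m : ∀ m n .{{_ : NonZero n}} → m % n ≢ 0 → (m / n) ℕ.* n < m
  m%n≢0⇒[m/n]*n<m m n m%n≢0 = subst ((m / n) ℕ.* n <_) (sym (m≡m%n+[m/n]*n m n)) (ℕP.m<n+m _ (ℕP.n≢0⇒n>0 m%n≢0))

  pos-∸ : ∀ {m n} → n ≤ m → + (m ℕ.∸ n) ≡ + m - + n
  pos-∸ {m} {n} n≤m = trans (sym (ℤP.⊖-≥ n≤m)) (sym (ℤP.m-n≡m⊖n m n))

  pos-pred : ∀ n .{{_ : NonZero n}} → + ℕ.pred n ≡ + n - + 1
  pos-pred (suc n) = refl

  <pred⇒suc< : ∀ {i n} .{{_ : NonZero n}} → i < ℕ.pred n → suc i < n
  <pred⇒suc< {n = n} i<n-1 = subst (suc _ <_) (ℕP.suc-pred n) (s<s i<n-1)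

module IntegerDedekindSum where
  open import Data.Nat as ℕ using (ℕ; zero; suc; NonZero)
  import Data.Nat.Properties as ℕP
  open import Data.Integer using (ℤ; +_; _+_; _*_; -_; _-_; _%ℕ_)
  import Data.Integer.Properties as ℤP
  open import Data.Integer.DivMod using (n%ℕd<d)
  open import Data.Integer.Tactic.RingSolver using (solve-∀)
  open import Data.Product using (_,_)
  open import Relation.Nullary.Negation using (contradiction)
  open import Relation.Binary.PropositionalEquality
  open ≡-Reasoning
  open FiniteSums
  open Remainders

  sawtoothʳ : ℕ → ℕ → ℤ
  sawtoothʳ k zero    = + 0
  sawtoothʳ k (suc r) = + 2 * + suc r - + k

  sawtoothʳ-nonzero : ∀ k {r} → r ≢ 0 → sawtoothʳ k r ≡ + 2 * + r - + k
  sawtoothʳ-nonzero k {zero}  r≢0 = contradiction refl r≢0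
  sawtoothʳ-nonzero k {suc r} _   = refl

  -- 2k · ((m / k)), the sawtooth function scaled to be integer valued
  sawtooth : (k : ℕ) .{{_ : NonZero k}} → ℤ → ℤ
  sawtooth k m = sawtoothʳ k (m %ℕ k)

  -- 4k² · s(a, k), where s is the classical Dedekind sum
  dedekind : ℤ → (k : ℕ) .{{_ : NonZero k}} → ℤ
  dedekind a k = ∑[ j < k ] (sawtooth k (+ j) * sawtooth k (+ j * a))

  sawtooth-periodic : ∀ k .{{_ : NonZero k}} m t → sawtooth k (m + t * + k) ≡ sawtooth k m
  sawtooth-periodic k m t = cong (sawtoothʳ k) (%ℕ-periodic m t k)

  sawtooth-odd : ∀ k .{{_ : NonZero k}} m → sawtooth k (- m) ≡ - sawtooth k m
  sawtooth-odd k m with m %ℕ k in m%k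
  ... | zero  = cong (sawtoothʳ k) (%ℕ-neg-zero m k m%k)
  ... | suc r with ℕP.m≤n⇒∃[o]m+o≡n (subst (ℕ._< k) m%k (n%ℕd<d m k))
  ...   | s , 2+r+s≡k = begin
    sawtoothʳ k ((- m) %ℕ k)       ≡⟨ cong (sawtoothʳ k) (%ℕ-neg-suc m k m%k k≡) ⟩
    + 2 * + suc s - + k            ≡⟨ cong (λ K → + 2 * + suc s - K) +k≡ ⟩
    + 2 * + suc s - (+ suc r + + suc s)     ≡⟨ reflect (+ suc r) (+ suc s) ⟩
    - (+ 2 * + suc r - (+ suc r + + suc s)) ≡⟨ cong (λ K → - (+ 2 * + suc r - K)) +k≡ ⟨
    - (+ 2 * + suc r - + k)        ∎
    where
    k≡ : k ≡ suc r ℕ.+ suc s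
    k≡ = trans (sym 2+r+s≡k) (sym (ℕP.+-suc (suc r) s))
    +k≡ : + k ≡ + suc r + + suc s
    +k≡ = trans (cong +_ k≡) (ℤP.pos-+ (suc r) (suc s))
    reflect : ∀ r s → + 2 * s - (r + s) ≡ - (+ 2 * r - (r + s))
    reflect = solve-∀

  dedekind-periodic : ∀ a t k .{{_ : NonZero k}} → dedekind (a + t * + k) k ≡ dedekind a k
  dedekind-periodic a t k = ∑-cong k (λ {j} _ → cong (sawtooth k (+ j) *_) (begin
    sawtooth k (+ j * (a + t * + k))           ≡⟨ cong (sawtooth k) (expand (+ j) a t (+ k)) ⟩
    sawtooth k (+ j * a + (+ j * t) * + k)     ≡⟨ sawtooth-periodic k (+ j * a) (+ j * t) ⟩
    sawtooth k (+ j * a)                       ∎))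
    where
    expand : ∀ j a t k → j * (a + t * k) ≡ j * a + (j * t) * k
    expand = solve-∀

  dedekind-odd : ∀ a k .{{_ : NonZero k}} → dedekind (- a) k ≡ - dedekind a k
  dedekind-odd a k = begin
    ∑[ j < k ] (sawtooth k (+ j) * sawtooth k (+ j * - a))
      ≡⟨ ∑-cong k (λ {j} _ → negate (+ j)) ⟩
    ∑[ j < k ] (- + 1 * (sawtooth k (+ j) * sawtooth k (+ j * a)))
      ≡⟨ ∑-*ˡ k (- + 1) (λ j → sawtooth k (+ j) * sawtooth k (+ j * a)) ⟩
    - + 1 * dedekind a k
      ≡⟨ ℤP.-1*i≡-i _ ⟩
    - dedekind a k ∎
    where
    negate : ∀ j → sawtooth k j * sawtooth k (j * - a) ≡ - + 1 * (sawtooth k j * sawtooth k (j * a))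
    negate j = begin
      sawtooth k j * sawtooth k (j * - a)        ≡⟨ cong (λ m → sawtooth k j * sawtooth k m) (ℤP.neg-distribʳ-* j a) ⟨
      sawtooth k j * sawtooth k (- (j * a))      ≡⟨ cong (sawtooth k j *_) (sawtooth-odd k (j * a)) ⟩
      sawtooth k j * - sawtooth k (j * a)        ≡⟨ ℤP.neg-distribʳ-* (sawtooth k j) (sawtooth k (j * a)) ⟨
      - (sawtooth k j * sawtooth k (j * a))      ≡⟨ ℤP.-1*i≡-i (sawtooth k j * sawtooth k (j * a)) ⟨
      - + 1 * (sawtooth k j * sawtooth k (j * a)) ∎

module Reciprocity where
  open import Data.Nat as ℕ using (ℕ; suc; NonZero; _<_; _≤_; _%_; _/_; z<s; pred)
  import Data.Nat.Properties as ℕP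
  open import Data.Nat.DivMod using (m≡m%n+[m/n]*n; m<n*o⇒m/o<n; m<n⇒m%n≡m; 0/n≡0)
  open import Data.Nat.Coprimality as Coprimality using (Coprime)
  open import Data.Integer as ℤ using (ℤ; +_; _+_; _*_; -_; _-_)
  import Data.Integer.Properties as ℤP
  open import Data.Integer.Tactic.RingSolver using (solve-∀; solve)
  open import Data.List using (_∷_; [])
  open import Relation.Binary.PropositionalEquality
  open FiniteSums
  open Remainders
  open IntegerDedekindSum
  open LinearCombination

  private
    linear-combinationℤ : ∀ {l r p q : ℤ} → p ≡ q → l + q ≡ r + p → l ≡ r
    linear-combinationℤ = linear-combination ℤP.+-*-commutativeRing

  module Division (a k : ℕ) .{{_ : NonZero a}} .{{_ : NonZero k}} (a⊥k : Coprime a k) where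

    r q : ℕ → ℕ
    r j = (j ℕ.* a) % k
    q j = (j ℕ.* a) / k

    S₁ S₂ X Y Q : ℤ
    S₁ = ∑[ j < k ] (+ j)
    S₂ = ∑[ j < k ] (+ j * + j)
    X  = ∑[ j < k ] (+ j * + q j)
    Y  = ∑[ j < k ] (+ q j * + q j)
    Q  = ∑[ j < k ] (+ q j)

    division : ∀ j → + j * + a ≡ + r j + + q j * + k
    division j = begin
      + j * + a                  ≡⟨ ℤP.pos-* j a ⟨
      + (j ℕ.* a)                ≡⟨ cong +_ (m≡m%n+[m/n]*n (j ℕ.* a) k) ⟩
      + (r j ℕ.+ q j ℕ.* k)      ≡⟨ ℤP.pos-+ (r j) (q j ℕ.* k) ⟩
      + r j + + (q j ℕ.* k)      ≡⟨ cong (_+_ (+ r j)) (ℤP.pos-* (q j) k) ⟩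
      + r j + + q j * + k        ∎
      where open ≡-Reasoning

    q<a : ∀ {j} → j < k → q j < a
    q<a {j} j<k = m<n*o⇒m/o<n (subst (j ℕ.* a <_) (ℕP.*-comm k a) (ℕP.*-monoˡ-< a j<k))

    ∑-remainder : ∑[ j < k ] (+ r j) ≡ S₁
    ∑-remainder = ∑-%-permute a k a⊥k (λ t → + t)

    ∑-remainder² : ∑[ j < k ] (+ r j * + r j) ≡ S₂
    ∑-remainder² = ∑-%-permute a k a⊥k (λ t → + t * + t)

    twice-S₁ : + 2 * S₁ ≡ + k * + k - + k
    twice-S₁ = trans (sym (∑-*ˡ k (+ 2) (λ j → + j))) (∑-even k)

    six-S₂ : + 6 * S₂ ≡ + 2 * (+ k * + k * + k) - + 3 * (+ k * + k) + + k
    six-S₂ = trans (sym (∑-*ˡ k (+ 6) (λ j → + j * + j))) (∑-square k)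

    quotient-sum : + 2 * Q ≡ (+ a - + 1) * (+ k - + 1)
    quotient-sum = ℤP.*-cancelˡ-≡ (+ k) _ _ (algebra (+ a) (+ k) S₁ Q ∑-quotients twice-S₁)
      where
      open ≡-Reasoning
      ∑-quotients : + a * S₁ ≡ S₁ + + k * Q
      ∑-quotients = begin
        + a * S₁                                    ≡⟨ ∑-*ˡ k (+ a) (λ j → + j) ⟨
        ∑[ j < k ] (+ a * + j)                      ≡⟨ ∑-cong k (λ {j} _ → divide j) ⟩
        ∑[ j < k ] (+ r j + + k * + q j)            ≡⟨ ∑-+ k (λ j → + r j) (λ j → + k * + q j) ⟩
        ∑[ j < k ] (+ r j) + ∑[ j < k ] (+ k * + q j) ≡⟨ cong₂ _+_ ∑-remainder (∑-*ˡ k (+ k) (λ j → + q j)) ⟩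
        S₁ + + k * Q                                ∎
        where
        divide : ∀ j → + a * + j ≡ + r j + + k * + q j
        divide j = trans (ℤP.*-comm (+ a) (+ j)) (trans (division j) (cong (_+_ (+ r j)) (ℤP.*-comm (+ q j) (+ k))))
      algebra : ∀ a k S Q → a * S ≡ S + k * Q → + 2 * S ≡ k * k - k → k * (+ 2 * Q) ≡ k * ((a - + 1) * (k - + 1))
      algebra a k S Q e₁ e₂ = linear-combinationℤ (cong₂ _+_ (cong (- + 2 *_) e₁) (cong ((a - + 1) *_) e₂))
                                                  (solve (a ∷ k ∷ S ∷ Q ∷ []))

    remainder : ∀ j → + r j ≡ + j * + a - + q j * + k
    remainder j = trans (add-sub (+ r j) (+ q j * + k)) (cong (_- + q j * + k) (sym (division j)))
      where
      add-sub : ∀ x y → x ≡ x + y - y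
      add-sub = solve-∀

    squares : S₂ ≡ + a * + a * S₂ + - (+ 2 * + a * + k) * X + + k * + k * Y
    squares = begin
      S₂
        ≡⟨ ∑-remainder² ⟨
      ∑[ j < k ] (+ r j * + r j)
        ≡⟨ ∑-cong k (λ {j} _ → trans (cong (λ x → x * x) (remainder j)) (expand (+ j) (+ a) (+ q j) (+ k))) ⟩
      ∑[ j < k ] (+ a * + a * (+ j * + j) + - (+ 2 * + a * + k) * (+ j * + q j) + + k * + k * (+ q j * + q j))
        ≡⟨ ∑-linear₃ k (+ a * + a) (- (+ 2 * + a * + k)) (+ k * + k) (λ j → + j * + j) (λ j → + j * + q j) (λ j → + q j * + q j) ⟩
      + a * + a * S₂ + - (+ 2 * + a * + k) * X + + k * + k * Y ∎
      where
      open ≡-Reasoning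
      expand : ∀ j a q k → (j * a - q * k) * (j * a - q * k) ≡ a * a * (j * j) + - (+ 2 * a * k) * (j * q) + k * k * (q * q)
      expand = solve-∀

    sawtooth-terms : ∀ {j} → 0 < j → j < k → sawtooth k (+ j) * sawtooth k (+ j * + a) ≡ (+ 2 * + j - + k) * (+ 2 * + r j - + k)
    sawtooth-terms {j} 0<j j<k = cong₂ _*_
      (trans (cong (sawtoothʳ k) (m<n⇒m%n≡m j<k)) (sawtoothʳ-nonzero k (ℕP.n>0⇒n≢0 0<j)))
      (trans (cong (λ m → sawtoothʳ k (m ℤ.%ℕ k)) (sym (ℤP.pos-* j a)))
             (sawtoothʳ-nonzero k (coprime⇒%≢0 (Coprimality.sym a⊥k) 0<j j<k)))

    dedekind-correction : dedekind (+ a) k + + k * + k ≡ ∑[ j < k ] ((+ 2 * + j - + k) * (+ 2 * + r j - + k))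
    dedekind-correction = begin
      dedekind (+ a) k + + k * + k
        ≡⟨ cong (_+ + k * + k) (∑-head k (λ j → sawtooth k (+ j) * sawtooth k (+ j * + a))) ⟩
      sawtooth k (+ 0) * sawtooth k (+ 0 * + a) + T + + k * + k
        ≡⟨ cong (λ s → s * sawtooth k (+ 0 * + a) + T + + k * + k) saw₀ ⟩
      + 0 + T + + k * + k
        ≡⟨ swap T (+ k) ⟩
      (+ 2 * + 0 - + k) * (+ 2 * + 0 - + k) + T
        ≡⟨ cong (λ x → (+ 2 * + 0 - + k) * (+ 2 * + x - + k) + T) r₀ ⟨
      (+ 2 * + 0 - + k) * (+ 2 * + r 0 - + k) + T
        ≡⟨ cong (_+_ ((+ 2 * + 0 - + k) * (+ 2 * + r 0 - + k))) (∑-cong (pred k) (λ i<k-1 → sawtooth-terms z<s (<pred⇒suc< i<k-1))) ⟩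
      (+ 2 * + 0 - + k) * (+ 2 * + r 0 - + k) + ∑[ i < pred k ] ((+ 2 * + suc i - + k) * (+ 2 * + r (suc i) - + k))
        ≡⟨ ∑-head k (λ j → (+ 2 * + j - + k) * (+ 2 * + r j - + k)) ⟨
      ∑[ j < k ] ((+ 2 * + j - + k) * (+ 2 * + r j - + k)) ∎
      where
      open ≡-Reasoning
      T = ∑[ i < pred k ] (sawtooth k (+ suc i) * sawtooth k (+ suc i * + a))
      0<k = ℕ.>-nonZero⁻¹ k
      saw₀ : sawtooth k (+ 0) ≡ + 0
      saw₀ = cong (sawtoothʳ k) (m<n⇒m%n≡m 0<k)
      r₀ : r 0 ≡ 0
      r₀ = m<n⇒m%n≡m 0<k
      swap : ∀ t k → + 0 + t + k * k ≡ (+ 2 * + 0 - k) * (+ 2 * + 0 - k) + t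
      swap = solve-∀

    dedekind-moments : dedekind (+ a) k ≡ + 4 * (+ a * S₂ - + k * X) - + k * + k * + k + + k * + k
    dedekind-moments = algebra (+ a) (+ k) (dedekind (+ a) k) S₁ S₂ X expanded ∑-jr twice-S₁
      where
      open ≡-Reasoning
      JR : ℤ
      JR = ∑[ j < k ] (+ j * + r j)
      ∑-jr : JR ≡ + a * S₂ + - + k * X
      ∑-jr = trans (∑-cong k (λ {j} _ → trans (cong (+ j *_) (remainder j)) (expand (+ j) (+ a) (+ q j) (+ k))))
                   (∑-linear₂ k (+ a) (- + k) (λ j → + j * + j) (λ j → + j * + q j))
        where
        expand : ∀ j a q k → j * (j * a - q * k) ≡ a * (j * j) + - k * (j * q)
        expand = solve-∀
      expanded : dedekind (+ a) k + + k * + k ≡ + 4 * JR + - (+ 2 * + k) * (S₁ + S₁) + + k * + k * + k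
      expanded = begin
        dedekind (+ a) k + + k * + k
          ≡⟨ dedekind-correction ⟩
        ∑[ j < k ] ((+ 2 * + j - + k) * (+ 2 * + r j - + k))
          ≡⟨ ∑-cong k (λ {j} _ → expand (+ j) (+ r j) (+ k)) ⟩
        ∑[ j < k ] (+ 4 * (+ j * + r j) + - (+ 2 * + k) * (+ j + + r j) + + k * + k * + 1)
          ≡⟨ ∑-linear₃ k (+ 4) (- (+ 2 * + k)) (+ k * + k) (λ j → + j * + r j) (λ j → + j + + r j) (λ _ → + 1) ⟩
        + 4 * JR + - (+ 2 * + k) * ∑[ j < k ] (+ j + + r j) + + k * + k * ∑[ j < k ] (+ 1)
          ≡⟨ cong₂ (λ s n → + 4 * JR + - (+ 2 * + k) * s + + k * + k * n)
              (trans (∑-+ k (λ j → + j) (λ j → + r j)) (cong (_+_ S₁) ∑-remainder)) (∑-ones k) ⟩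
        + 4 * JR + - (+ 2 * + k) * (S₁ + S₁) + + k * + k * + k ∎
        where
        expand : ∀ j r k → (+ 2 * j - k) * (+ 2 * r - k) ≡ + 4 * (j * r) + - (+ 2 * k) * (j + r) + k * k * + 1
        expand = solve-∀
      algebra : ∀ a k D S₁ S₂ X {JR} → D + k * k ≡ + 4 * JR + - (+ 2 * k) * (S₁ + S₁) + k * k * k →
                JR ≡ a * S₂ + - k * X → + 2 * S₁ ≡ k * k - k → D ≡ + 4 * (a * S₂ - k * X) - k * k * k + k * k
      algebra a k D S₁ S₂ X e₁ refl e₂ = linear-combinationℤ (cong₂ _+_ e₁ (cong (- (+ 2 * k) *_) e₂))
                                                            (solve (a ∷ k ∷ D ∷ S₁ ∷ S₂ ∷ X ∷ []))

  module DoubleCounting (a k : ℕ) .{{_ : NonZero a}} .{{_ : NonZero k}} (a⊥k : Coprime a k) where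
    open Division a k a⊥k using (q; q<a; Y)
    open Division k a (Coprimality.sym a⊥k) using () renaming (q to p; q<a to p<k; X to X′; Q to Q′)

    -- q j² = ∑[ i < q j ] (2i + 1); after exchanging the sums, row i counts the j < k with (i + 1) k ≤ j a
    quotient-square : ∀ {j} → j < k → + q j * + q j ≡ ∑[ i < a ] ((+ 2 * + i + + 1) * 𝟙 (i ℕ.<? q j))
    quotient-square {j} j<k = sym (trans (∑-𝟙-prefix (λ i → + 2 * + i + + 1) (ℕP.<⇒≤ (q<a j<k))) (∑-odd (q j)))

    row : ℕ → ℤ
    row i = ∑[ j < k ] 𝟙 (i ℕ.<? q j)

    row-count : ∀ {i} → suc i < a → row i ≡ + (k ℕ.∸ suc (p (suc i)))
    row-count {i} 1+i<a = trans (∑-cong k (λ {j} _ → 𝟙-cong (i ℕ.<? q j) (suc (p (suc i)) ℕ.≤? j) below above))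
                                 (∑-𝟙-suffix (p<k 1+i<a))
      where
      M = suc i ℕ.* k
      M%a≢0 : M % a ≢ 0
      M%a≢0 = coprime⇒%≢0 a⊥k z<s 1+i<a
      below : ∀ {j} → i < q j → suc (p (suc i)) ≤ j
      below {j} i<qj = ℕP.*-cancelʳ-< a (p (suc i)) j
        (ℕP.<-≤-trans (m%n≢0⇒[m/n]*n<m M a M%a≢0) (m≤n/o⇒m*o≤n (suc i) (j ℕ.* a) k i<qj))
      above : ∀ {j} → suc (p (suc i)) ≤ j → i < q j
      above {j} p<j = m*o≤n⇒m≤n/o (suc i) (j ℕ.* a) k (ℕP.<⇒≤ (ℕP.<-≤-trans (m<[1+m/n]*n M a) (ℕP.*-monoˡ-≤ a p<j)))

    last-row : row (pred a) ≡ + 0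
    last-row = ∑-zero k (λ {j} j<k → 𝟙-no (pred a ℕ.<? q j)
                          (λ a-1<qj → ℕP.<⇒≱ (q<a j<k) (subst (_≤ q j) (ℕP.suc-pred a) a-1<qj)))

    rows : Y ≡ ∑[ i < a ] ((+ 2 * + i + + 1) * row i)
    rows = begin
      Y
        ≡⟨ ∑-cong k quotient-square ⟩
      ∑[ j < k ] ∑[ i < a ] ((+ 2 * + i + + 1) * 𝟙 (i ℕ.<? q j))
        ≡⟨ ∑-swap k a (λ j i → (+ 2 * + i + + 1) * 𝟙 (i ℕ.<? q j)) ⟩
      ∑[ i < a ] ∑[ j < k ] ((+ 2 * + i + + 1) * 𝟙 (i ℕ.<? q j))
        ≡⟨ ∑-cong a (λ {i} _ → ∑-*ˡ k (+ 2 * + i + + 1) (λ j → 𝟙 (i ℕ.<? q j))) ⟩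
      ∑[ i < a ] ((+ 2 * + i + + 1) * row i) ∎
      where open ≡-Reasoning

    rows-counted : ∑[ i < a ] ((+ 2 * + i + + 1) * row i) ≡ ∑[ i < pred a ] ((+ 2 * + i + + 1) * (+ k - + suc (p (suc i))))
    rows-counted = begin
      ∑[ i < a ] ((+ 2 * + i + + 1) * row i)
        ≡⟨ cong (λ n → ∑[ i < n ] ((+ 2 * + i + + 1) * row i)) (ℕP.suc-pred a) ⟨
      ∑[ i < suc (pred a) ] ((+ 2 * + i + + 1) * row i)
        ≡⟨ ∑-last (pred a) (λ i → (+ 2 * + i + + 1) * row i) ⟩
      ∑[ i < pred a ] ((+ 2 * + i + + 1) * row i) + (+ 2 * + pred a + + 1) * row (pred a)
        ≡⟨ cong₂ _+_ (∑-cong (pred a) counted) (trans (cong ((+ 2 * + pred a + + 1) *_) last-row) (ℤP.*-zeroʳ (+ 2 * + pred a + + 1))) ⟩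
      ∑[ i < pred a ] ((+ 2 * + i + + 1) * (+ k - + suc (p (suc i)))) + + 0
        ≡⟨ ℤP.+-identityʳ _ ⟩
      ∑[ i < pred a ] ((+ 2 * + i + + 1) * (+ k - + suc (p (suc i)))) ∎
      where
      open ≡-Reasoning
      counted : ∀ {i} → i < pred a → (+ 2 * + i + + 1) * row i ≡ (+ 2 * + i + + 1) * (+ k - + suc (p (suc i)))
      counted {i} i<a-1 = cong ((+ 2 * + i + + 1) *_) (trans (row-count (<pred⇒suc< i<a-1)) (pos-∸ (p<k (<pred⇒suc< i<a-1))))

    double-counting : Y ≡ (+ k - + 1) * ((+ a - + 1) * (+ a - + 1)) - + 2 * X′ + Q′
    double-counting = begin
      Y
        ≡⟨ trans rows rows-counted ⟩
      ∑[ i < pred a ] ((+ 2 * + i + + 1) * (+ k - + suc (p (suc i))))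
        ≡⟨ ∑-cong (pred a) (λ {i} _ → expand (+ i) (+ k) (+ p (suc i))) ⟩
      ∑[ i < pred a ] ((+ k - + 1) * (+ 2 * + i + + 1) + - + 2 * (+ suc i * + p (suc i)) + + 1 * + p (suc i))
        ≡⟨ ∑-linear₃ (pred a) (+ k - + 1) (- + 2) (+ 1) (λ i → + 2 * + i + + 1) (λ i → + suc i * + p (suc i)) (λ i → + p (suc i)) ⟩
      (+ k - + 1) * ∑[ i < pred a ] (+ 2 * + i + + 1) + - + 2 * ∑[ i < pred a ] (+ suc i * + p (suc i))
        + + 1 * ∑[ i < pred a ] (+ p (suc i))
        ≡⟨ cong₃ (λ s x t → (+ k - + 1) * s + - + 2 * x + + 1 * t) (trans (∑-odd (pred a)) (cong (λ n → n * n) (pos-pred a)))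
            (sym X′-tail) (sym Q′-tail) ⟩
      (+ k - + 1) * ((+ a - + 1) * (+ a - + 1)) + - + 2 * X′ + + 1 * Q′
        ≡⟨ tidy (+ k - + 1) ((+ a - + 1) * (+ a - + 1)) X′ Q′ ⟩
      (+ k - + 1) * ((+ a - + 1) * (+ a - + 1)) - + 2 * X′ + Q′ ∎
      where
      open ≡-Reasoning
      cong₃ : ∀ (f : ℤ → ℤ → ℤ → ℤ) {x x′ y y′ z z′} → x ≡ x′ → y ≡ y′ → z ≡ z′ →
              f x y z ≡ f x′ y′ z′
      cong₃ f refl refl refl = refl
      expand : ∀ i k p → (+ 2 * i + + 1) * (k - (+ 1 + p)) ≡ (k - + 1) * (+ 2 * i + + 1) + - + 2 * ((+ 1 + i) * p) + + 1 * p
      expand = solve-∀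
      tidy : ∀ c s x t → c * s + - + 2 * x + + 1 * t ≡ c * s - + 2 * x + t
      tidy = solve-∀
      X′-tail : X′ ≡ ∑[ i < pred a ] (+ suc i * + p (suc i))
      X′-tail = trans (∑-head a (λ i → + i * + p i)) (ℤP.+-identityˡ _)
      Q′-tail : Q′ ≡ ∑[ i < pred a ] (+ p (suc i))
      Q′-tail = trans (∑-head a (λ i → + p i)) (trans (cong (λ x → + x + ∑[ i < pred a ] (+ p (suc i))) (0/n≡0 a)) (ℤP.+-identityˡ _))

  reciprocity : ∀ a k .{{_ : NonZero a}} .{{_ : NonZero k}} → Coprime a k →
                + 3 * (+ a * + a * dedekind (+ a) k + + k * + k * dedekind (+ k) a)
                ≡ + a * + k * (+ a * + a + + k * + k + + 1 - + 3 * + a * + k)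
  reciprocity a k a⊥k =
    algebra (+ a) (+ k) A.S₂ K.S₂ A.X K.X K.Q A.dedekind-moments K.dedekind-moments
            (DoubleCounting.double-counting a k a⊥k) A.squares K.quotient-sum A.six-S₂ K.six-S₂
    where
    module A = Division a k a⊥k
    module K = Division k a (Coprimality.sym a⊥k)
    algebra : ∀ a k S₂ S₂′ X X′ Q′ {D D′ Y} →
              D ≡ + 4 * (a * S₂ - k * X) - k * k * k + k * k →
              D′ ≡ + 4 * (k * S₂′ - a * X′) - a * a * a + a * a →
              Y ≡ (k - + 1) * ((a - + 1) * (a - + 1)) - + 2 * X′ + Q′ →
              S₂ ≡ a * a * S₂ + - (+ 2 * a * k) * X + k * k * Y →
              + 2 * Q′ ≡ (k - + 1) * (a - + 1) →
              + 6 * S₂ ≡ + 2 * (k * k * k) - + 3 * (k * k) + k →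
              + 6 * S₂′ ≡ + 2 * (a * a * a) - + 3 * (a * a) + a →
              + 3 * (a * a * D + k * k * D′) ≡ a * k * (a * a + k * k + + 1 - + 3 * a * k)
    algebra a k S₂ S₂′ X X′ Q′ refl refl refl squares quotients six-S₂ six-S₂′ = linear-combinationℤ
      (cong₂ _+_ (cong₂ _+_ (cong (- (+ 6 * a) *_) squares) (cong (- (+ 3 * a * k * k) *_) quotients))
                 (cong₂ _+_ (cong ((a * a * a + a) *_) six-S₂) (cong (+ 2 * k * k * k *_) six-S₂′)))
      (solve (a ∷ k ∷ S₂ ∷ S₂′ ∷ X ∷ X′ ∷ Q′ ∷ []))

module RationalArithmetic where
  open import Data.Nat as ℕ using (ℕ; suc; NonZero)
  import Data.Nat.Properties as ℕP
  open import Data.Integer as ℤ using (ℤ; +_)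
  import Data.Integer.Properties as ℤP
  open import Data.Integer.GCD using (gcd)
  open import Data.Integer.Tactic.RingSolver using (solve-∀)
  open import Data.Rational as ℚ using (ℚ; _/_; 0ℚ; 1ℚ; ↥_; ↧_; _+_; _*_; _-_; -_)
  import Data.Rational.Properties as ℚP
  import Data.Rational.Unnormalised as ℚᵘ
  import Data.Rational.Unnormalised.Properties as ℚᵘP
  open import Data.List using (_∷_; [])
  open import Data.Maybe using (Maybe; just; nothing)
  open import Relation.Nullary using (yes; no)
  open import Relation.Binary.PropositionalEquality
  import Tactic.RingSolver as RingSolver
  import Tactic.RingSolver.Core.AlmostCommutativeRing as ACR
  open import Level using (0ℓ)
  open LinearCombination

  ℚ-ring : ACR.AlmostCommutativeRing 0ℓ 0ℓ
  ℚ-ring = ACR.fromCommutativeRing ℚP.+-*-commutativeRing isZero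
    where
    isZero : (x : ℚ) → Maybe (0ℚ ≡ x)
    isZero x with 0ℚ ℚP.≟ x
    ... | yes 0≡x = just 0≡x
    ... | no _    = nothing

  linear-combinationℚ : ∀ {l r p q : ℚ} → p ≡ q → l + q ≡ r + p → l ≡ r
  linear-combinationℚ = linear-combination ℚP.+-*-commutativeRing

  toℚᵘ-/ : ∀ i n .{{_ : NonZero n}} → ℚ.toℚᵘ (i / n) ℚᵘ.≃ (i ℚᵘ./ n)
  toℚᵘ-/ i n@(suc _) = ℚᵘ.*≡* (begin
    ↥ᵘ (i / n) ℤ.* + n                          ≡⟨ cong (ℤ._* + n) (ℚP.↥ᵘ-toℚᵘ (i / n)) ⟩
    ↥ (i / n) ℤ.* + n                           ≡⟨ cong (↥ (i / n) ℤ.*_) (ℚP.↧-/ i n) ⟨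
    ↥ (i / n) ℤ.* (↧ (i / n) ℤ.* gcd i (+ n))   ≡⟨ regroup (↥ (i / n)) (↧ (i / n)) (gcd i (+ n)) ⟩
    ↥ (i / n) ℤ.* gcd i (+ n) ℤ.* ↧ (i / n)     ≡⟨ cong (ℤ._* ↧ (i / n)) (ℚP.↥-/ i n) ⟩
    i ℤ.* ↧ (i / n)                             ≡⟨ cong (i ℤ.*_) (ℚP.↧ᵘ-toℚᵘ (i / n)) ⟨
    i ℤ.* ↧ᵘ (i / n)                            ∎)
    where
    open ≡-Reasoning
    ↥ᵘ_ ↧ᵘ_ : ℚ → ℤ
    ↥ᵘ p = ℚᵘ.↥ (ℚ.toℚᵘ p)
    ↧ᵘ p = ℚᵘ.↧ (ℚ.toℚᵘ p)
    regroup : ∀ x y z → x ℤ.* (y ℤ.* z) ≡ x ℤ.* z ℤ.* y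
    regroup = solve-∀

  /-≡ : ∀ i m j n .{{_ : NonZero m}} .{{_ : NonZero n}} → i ℤ.* + n ≡ j ℤ.* + m → i / m ≡ j / n
  /-≡ i m@(suc _) j n@(suc _) eq =
    ℚP.toℚᵘ-injective (ℚᵘP.≃-trans (toℚᵘ-/ i m) (ℚᵘP.≃-trans (ℚᵘ.*≡* eq) (ℚᵘP.≃-sym (toℚᵘ-/ j n))))

  /-+ : ∀ i m j n → i / suc m + j / suc n ≡ (i ℤ.* + suc n ℤ.+ j ℤ.* + suc m) / (suc m ℕ.* suc n)
  /-+ i m j n = ℚP.toℚᵘ-injective (ℚᵘP.≃-trans (ℚP.toℚᵘ-homo-+ (i / suc m) (j / suc n))
    (ℚᵘP.≃-trans (ℚᵘP.+-cong (toℚᵘ-/ i (suc m)) (toℚᵘ-/ j (suc n))) (ℚᵘP.≃-sym (toℚᵘ-/ _ (suc m ℕ.* suc n)))))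

  /-* : ∀ i m j n → (i / suc m) * (j / suc n) ≡ (i ℤ.* j) / (suc m ℕ.* suc n)
  /-* i m j n = ℚP.toℚᵘ-injective (ℚᵘP.≃-trans (ℚP.toℚᵘ-homo-* (i / suc m) (j / suc n))
    (ℚᵘP.≃-trans (ℚᵘP.*-cong (toℚᵘ-/ i (suc m)) (toℚᵘ-/ j (suc n))) (ℚᵘP.≃-sym (toℚᵘ-/ _ (suc m ℕ.* suc n)))))

  /-neg : ∀ i n .{{_ : NonZero n}} → - (i / n) ≡ (ℤ.- i) / n
  /-neg i n@(suc _) = ℚP.toℚᵘ-injective (ℚᵘP.≃-trans (ℚP.toℚᵘ-homo‿- (i / n))
    (ℚᵘP.≃-trans (ℚᵘP.-‿cong (toℚᵘ-/ i n)) (ℚᵘP.≃-sym (toℚᵘ-/ (ℤ.- i) n))))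

  fromℤ : ℤ → ℚ
  fromℤ i = i / 1

  1/ℕ : (n : ℕ) .{{_ : NonZero n}} → ℚ
  1/ℕ n = + 1 / n

  fromℤ-+ : ∀ i j → fromℤ (i ℤ.+ j) ≡ fromℤ i + fromℤ j
  fromℤ-+ i j = sym (trans (/-+ i 0 j 0) (/-≡ (i ℤ.* + 1 ℤ.+ j ℤ.* + 1) 1 (i ℤ.+ j) 1 (unit i j)))
    where
    unit : ∀ i j → (i ℤ.* + 1 ℤ.+ j ℤ.* + 1) ℤ.* + 1 ≡ (i ℤ.+ j) ℤ.* + 1
    unit = solve-∀

  fromℤ-* : ∀ i j → fromℤ (i ℤ.* j) ≡ fromℤ i * fromℤ j
  fromℤ-* i j = sym (/-* i 0 j 0)

  fromℤ-neg : ∀ i → fromℤ (ℤ.- i) ≡ - fromℤ i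
  fromℤ-neg i = sym (/-neg i 1)

  fromℤ-- : ∀ i j → fromℤ (i ℤ.- j) ≡ fromℤ i - fromℤ j
  fromℤ-- i j = trans (fromℤ-+ i (ℤ.- j)) (cong (_+_ (fromℤ i)) (fromℤ-neg j))

  /≡fromℤ*1/ℕ : ∀ i n .{{_ : NonZero n}} → i / n ≡ fromℤ i * 1/ℕ n
  /≡fromℤ*1/ℕ i n@(suc n′) = sym (trans (/-* i 0 (+ 1) n′) (/-≡ (i ℤ.* + 1) (1 ℕ.* n) i n
    (trans (cong (ℤ._* + n) (ℤP.*-identityʳ i)) (cong (λ m → i ℤ.* + m) (sym (ℕP.*-identityˡ n))))))

  fromℤ*1/ℕ : ∀ n .{{_ : NonZero n}} → fromℤ (+ n) * 1/ℕ n ≡ 1ℚ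
  fromℤ*1/ℕ n@(suc _) =
    trans (sym (/≡fromℤ*1/ℕ (+ n) n)) (/-≡ (+ n) n (+ 1) 1 (trans (ℤP.*-identityʳ (+ n)) (sym (ℤP.*-identityˡ (+ n)))))

  1/ℕ-cofactor : ∀ k d m .{{_ : NonZero k}} .{{_ : NonZero m}} → m ≡ k ℕ.* d → 1/ℕ k ≡ fromℤ (+ d) * 1/ℕ m
  1/ℕ-cofactor k@(suc _) d m@(suc m′) m≡kd = sym (trans (/-* (+ d) 0 (+ 1) m′) (/-≡ (+ d ℤ.* + 1) (1 ℕ.* m) (+ 1) k cross))
    where
    cross : + d ℤ.* + 1 ℤ.* + k ≡ + 1 ℤ.* + (1 ℕ.* m)
    cross = begin
      + d ℤ.* + 1 ℤ.* + k     ≡⟨ cong (ℤ._* + k) (ℤP.*-identityʳ (+ d)) ⟩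
      + d ℤ.* + k             ≡⟨ ℤP.pos-* d k ⟨
      + (d ℕ.* k)             ≡⟨ cong +_ (trans (ℕP.*-comm d k) (trans (sym m≡kd) (sym (ℕP.*-identityˡ m)))) ⟩
      + (1 ℕ.* m)             ≡⟨ ℤP.*-identityˡ (+ (1 ℕ.* m)) ⟨
      + 1 ℤ.* + (1 ℕ.* m)     ∎
      where open ≡-Reasoning

  cancel-negated-multiple : ∀ k .{{_ : NonZero k}} x y z →
                            - (fromℤ (+ k) * x) ≡ - (fromℤ (+ k) * y) + - (fromℤ (+ k) * z) → x ≡ y + z
  cancel-negated-multiple k x y z eq = algebra x y z (fromℤ (+ k)) (1/ℕ k) eq (fromℤ*1/ℕ k)
    where
    algebra : ∀ x y z κ i → - (κ * x) ≡ - (κ * y) + - (κ * z) → κ * i ≡ 1ℚ → x ≡ y + z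
    algebra x y z κ i eq κi≡1 = linear-combinationℚ (cong₂ _+_ (cong (- i *_) eq) (cong (- (x - y - z) *_) κi≡1))
                                                    (RingSolver.solve (x ∷ y ∷ z ∷ κ ∷ i ∷ []) ℚ-ring)

module DedekindSum where
  open import Data.Nat as ℕ using (ℕ; zero; suc; NonZero)
  import Data.Nat.Properties as ℕP
  open import Data.Nat.Coprimality using (Coprime)
  open import Data.Integer as ℤ using (ℤ; +_; ∣_∣)
  import Data.Integer.Properties as ℤP
  open import Data.Integer.Tactic.RingSolver using (solve-∀)
  open import Data.Rational as ℚ using (ℚ; mkℚ; 0ℚ; 1ℚ; ½; _+_; _*_; _-_; -_)
  import Data.Rational.Properties as ℚP
  open import Data.List using (_∷_; []; map; applyUpTo; upTo)
  open import Data.List.Properties using (map-cong)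
  open import Function using (id)
  open import Relation.Binary.PropositionalEquality
  import Tactic.RingSolver as RingSolver
  open FiniteSums
  open IntegerDedekindSum
  open Reciprocity using (reciprocity)
  open RationalArithmetic

  s : ℤ → (k : ℕ) .{{_ : NonZero k}} → ℚ
  s a k = fromℤ (dedekind a k) * (1/ℕ k * 1/ℕ k * 1/ℕ 4)

  s-periodic : ∀ a t k .{{_ : NonZero k}} → s (a ℤ.+ t ℤ.* + k) k ≡ s a k
  s-periodic a t k = cong (λ d → fromℤ d * (1/ℕ k * 1/ℕ k * 1/ℕ 4)) (dedekind-periodic a t k)

  s-odd : ∀ a k .{{_ : NonZero k}} → s (ℤ.- a) k ≡ - s a k
  s-odd a k = trans (cong (_* (1/ℕ k * 1/ℕ k * 1/ℕ 4)) (trans (cong fromℤ (dedekind-odd a k)) (fromℤ-neg (dedekind a k))))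
                    (sym (ℚP.neg-distribˡ-* (fromℤ (dedekind a k)) (1/ℕ k * 1/ℕ k * 1/ℕ 4)))

  s-1 : ∀ a → s a 1 ≡ 0ℚ
  s-1 a = ℚP.*-zeroˡ (1/ℕ 1 * 1/ℕ 1 * 1/ℕ 4)

  saw≡sawtooth : ∀ m k .{{_ : NonZero k}} → saw m k ≡ fromℤ (sawtooth k m) * (1/ℕ k * ½)
  saw≡sawtooth m k with m ℤ.%ℕ k
  ... | zero  = sym (ℚP.*-zeroˡ (1/ℕ k * ½))
  ... | suc r = begin
    + suc r ℚ./ k - ½
      ≡⟨ cong (_- ½) (/≡fromℤ*1/ℕ (+ suc r) k) ⟩
    fromℤ (+ suc r) * 1/ℕ k - ½
      ≡⟨ algebra (fromℤ (+ suc r)) (fromℤ (+ k)) (1/ℕ k) ½ (fromℤ*1/ℕ k) refl ⟩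
    (fromℤ (+ 2) * fromℤ (+ suc r) - fromℤ (+ k)) * (1/ℕ k * ½)
      ≡⟨ cong (λ x → (x - fromℤ (+ k)) * (1/ℕ k * ½)) (fromℤ-* (+ 2) (+ suc r)) ⟨
    (fromℤ (+ 2 ℤ.* + suc r) - fromℤ (+ k)) * (1/ℕ k * ½)
      ≡⟨ cong (_* (1/ℕ k * ½)) (fromℤ-- (+ 2 ℤ.* + suc r) (+ k)) ⟨
    fromℤ (+ 2 ℤ.* + suc r ℤ.- + k) * (1/ℕ k * ½) ∎
    where
    open ≡-Reasoning
    algebra : ∀ r k i h → k * i ≡ 1ℚ → fromℤ (+ 2) * h ≡ 1ℚ → r * i - h ≡ (fromℤ (+ 2) * r - k) * (i * h)
    algebra r k i h ki≡1 2h≡1 = linear-combinationℚ (cong₂ _+_ (cong (h *_) ki≡1) (cong (- (r * i) *_) 2h≡1))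
                                                    (RingSolver.solve (r ∷ k ∷ i ∷ h ∷ []) ℚ-ring)

  sumℚ-upTo : ∀ n (g : ℕ → ℕ) (f : ℕ → ℤ) c →
              sumℚ (map (λ j → fromℤ (f j) * c) (map suc (applyUpTo g n))) ≡ fromℤ (∑[ i < n ] f (suc (g i))) * c
  sumℚ-upTo zero    g f c = sym (ℚP.*-zeroˡ c)
  sumℚ-upTo (suc n) g f c = begin
    fromℤ (f (suc (g 0))) * c + sumℚ (map (λ j → fromℤ (f j) * c) (map suc (applyUpTo (λ i → g (suc i)) n)))
      ≡⟨ cong (_+_ (fromℤ (f (suc (g 0))) * c)) (sumℚ-upTo n (λ i → g (suc i)) f c) ⟩
    fromℤ (f (suc (g 0))) * c + fromℤ T * c
      ≡⟨ ℚP.*-distribʳ-+ c (fromℤ (f (suc (g 0)))) (fromℤ T) ⟨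
    (fromℤ (f (suc (g 0))) + fromℤ T) * c
      ≡⟨ cong (_* c) (fromℤ-+ (f (suc (g 0))) T) ⟨
    fromℤ (f (suc (g 0)) ℤ.+ T) * c ∎
    where
    open ≡-Reasoning
    T = ∑[ i < n ] f (suc (g (suc i)))

  D≡s : ∀ a k .(a⊥k : Coprime ∣ a ∣ (suc k)) → D (mkℚ a k a⊥k) ≡ s a (suc k)
  D≡s a k _ = begin
    sumℚ (map (λ j → saw (+ j) K * saw (+ j ℤ.* a) K) (map suc (upTo k)))
      ≡⟨ cong sumℚ (map-cong term≡ (map suc (upTo k))) ⟩
    sumℚ (map (λ j → fromℤ (f j) * c) (map suc (upTo k)))
      ≡⟨ sumℚ-upTo k id f c ⟩
    fromℤ (∑[ i < k ] f (suc i)) * c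
      ≡⟨ cong (λ x → fromℤ x * c) (ℤP.+-identityˡ (∑[ i < k ] f (suc i))) ⟨
    fromℤ (dedekind a K) * c ∎
    where
    open ≡-Reasoning
    K = suc k
    c = 1/ℕ K * 1/ℕ K * 1/ℕ 4
    f : ℕ → ℤ
    f j = sawtooth K (+ j) ℤ.* sawtooth K (+ j ℤ.* a)
    term≡ : ∀ j → saw (+ j) K * saw (+ j ℤ.* a) K ≡ fromℤ (f j) * c
    term≡ j = begin
      saw (+ j) K * saw (+ j ℤ.* a) K
        ≡⟨ cong₂ _*_ (saw≡sawtooth (+ j) K) (saw≡sawtooth (+ j ℤ.* a) K) ⟩
      fromℤ (sawtooth K (+ j)) * (1/ℕ K * ½) * (fromℤ (sawtooth K (+ j ℤ.* a)) * (1/ℕ K * ½))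
        ≡⟨ algebra (fromℤ (sawtooth K (+ j))) (fromℤ (sawtooth K (+ j ℤ.* a))) (1/ℕ K) ½ (1/ℕ 4) refl ⟩
      fromℤ (sawtooth K (+ j)) * fromℤ (sawtooth K (+ j ℤ.* a)) * c
        ≡⟨ cong (_* c) (fromℤ-* (sawtooth K (+ j)) (sawtooth K (+ j ℤ.* a))) ⟨
      fromℤ (f j) * c ∎
      where
      algebra : ∀ x y i h q → h * h ≡ q → x * (i * h) * (y * (i * h)) ≡ x * y * (i * i * q)
      algebra x y i h q refl = RingSolver.solve (x ∷ y ∷ i ∷ h ∷ []) ℚ-ring

  s-reciprocity : ∀ a k .{{_ : NonZero a}} .{{_ : NonZero k}} → Coprime a k →
                  fromℤ (+ 12) * (s (+ a) k + s (+ k) a)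
                  ≡ (fromℤ (+ a) * fromℤ (+ a) + fromℤ (+ k) * fromℤ (+ k) + 1ℚ) * (1/ℕ a * 1/ℕ k) - fromℤ (+ 3)
  s-reciprocity a k a⊥k =
    algebra (fromℤ (+ a)) (fromℤ (+ k)) (fromℤ (dedekind (+ a) k)) (fromℤ (dedekind (+ k) a)) (1/ℕ a) (1/ℕ k) (1/ℕ 4)
            (fromℤ*1/ℕ a) (fromℤ*1/ℕ k) (fromℤ*1/ℕ 4)
            (trans (sym (fromℤ-lhs (+ a) (+ k) (dedekind (+ a) k) (dedekind (+ k) a)))
                   (trans (cong fromℤ (reciprocity a k a⊥k)) (fromℤ-rhs (+ a) (+ k))))
    where
    open ≡-Reasoning
    fromℤ-square-* : ∀ x y → fromℤ (x ℤ.* x ℤ.* y) ≡ fromℤ x * fromℤ x * fromℤ y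
    fromℤ-square-* x y = trans (fromℤ-* (x ℤ.* x) y) (cong (_* fromℤ y) (fromℤ-* x x))
    fromℤ-lhs : ∀ a k d d′ → fromℤ (+ 3 ℤ.* (a ℤ.* a ℤ.* d ℤ.+ k ℤ.* k ℤ.* d′))
                             ≡ fromℤ (+ 3) * (fromℤ a * fromℤ a * fromℤ d + fromℤ k * fromℤ k * fromℤ d′)
    fromℤ-lhs a k d d′ = trans (fromℤ-* (+ 3) (a ℤ.* a ℤ.* d ℤ.+ k ℤ.* k ℤ.* d′)) (cong (fromℤ (+ 3) *_)
      (trans (fromℤ-+ (a ℤ.* a ℤ.* d) (k ℤ.* k ℤ.* d′)) (cong₂ _+_ (fromℤ-square-* a d) (fromℤ-square-* k d′))))
    fromℤ-rhs : ∀ a k → fromℤ (a ℤ.* k ℤ.* (a ℤ.* a ℤ.+ k ℤ.* k ℤ.+ + 1 ℤ.- + 3 ℤ.* a ℤ.* k))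
                        ≡ fromℤ a * fromℤ k * (fromℤ a * fromℤ a + fromℤ k * fromℤ k + 1ℚ - fromℤ (+ 3) * fromℤ a * fromℤ k)
    fromℤ-rhs a k = begin
      fromℤ (a ℤ.* k ℤ.* (a ℤ.* a ℤ.+ k ℤ.* k ℤ.+ + 1 ℤ.- + 3 ℤ.* a ℤ.* k))
        ≡⟨ fromℤ-* (a ℤ.* k) (a ℤ.* a ℤ.+ k ℤ.* k ℤ.+ + 1 ℤ.- + 3 ℤ.* a ℤ.* k) ⟩
      fromℤ (a ℤ.* k) * fromℤ (a ℤ.* a ℤ.+ k ℤ.* k ℤ.+ + 1 ℤ.- + 3 ℤ.* a ℤ.* k)
        ≡⟨ cong₂ _*_ (fromℤ-* a k) (fromℤ-- (a ℤ.* a ℤ.+ k ℤ.* k ℤ.+ + 1) (+ 3 ℤ.* a ℤ.* k)) ⟩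
      fromℤ a * fromℤ k * (fromℤ (a ℤ.* a ℤ.+ k ℤ.* k ℤ.+ + 1) - fromℤ (+ 3 ℤ.* a ℤ.* k))
        ≡⟨ cong₂ (λ x y → fromℤ a * fromℤ k * (x - y))
            (trans (fromℤ-+ (a ℤ.* a ℤ.+ k ℤ.* k) (+ 1))
                   (cong (_+ 1ℚ) (trans (fromℤ-+ (a ℤ.* a) (k ℤ.* k)) (cong₂ _+_ (fromℤ-* a a) (fromℤ-* k k)))))
            (trans (fromℤ-* (+ 3 ℤ.* a) k) (cong (_* fromℤ k) (fromℤ-* (+ 3) a))) ⟩
      fromℤ a * fromℤ k * (fromℤ a * fromℤ a + fromℤ k * fromℤ k + 1ℚ - fromℤ (+ 3) * fromℤ a * fromℤ k)
        ∎
    algebra : ∀ A K D D′ iA iK q → A * iA ≡ 1ℚ → K * iK ≡ 1ℚ → fromℤ (+ 4) * q ≡ 1ℚ →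
              fromℤ (+ 3) * (A * A * D + K * K * D′) ≡ A * K * (A * A + K * K + 1ℚ - fromℤ (+ 3) * A * K) →
              fromℤ (+ 12) * (D * (iK * iK * q) + D′ * (iA * iA * q)) ≡ (A * A + K * K + 1ℚ) * (iA * iK) - fromℤ (+ 3)
    algebra A K D D′ iA iK q AiA≡1 KiK≡1 4q≡1 H = linear-combinationℚ
      (cong₂ _+_
        (cong₂ _+_
          (cong ((- (fromℤ (+ 3) * D * iK * iK * (A * iA + 1ℚ)) + K * iK * (A * A + K * K + 1ℚ) * iA * iK
                   - fromℤ (+ 3) * (K * iK) * (A * iA * (K * iK) + 1ℚ)) *_) AiA≡1)
          (cong ((- (fromℤ (+ 3) * D′ * iA * iA * (K * iK + 1ℚ)) + (A * A + K * K + 1ℚ) * iA * iK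
                   - fromℤ (+ 3) * (A * iA * (K * iK) + 1ℚ)) *_) KiK≡1))
        (cong₂ _+_ (cong (fromℤ (+ 3) * (D * iK * iK + D′ * iA * iA) *_) 4q≡1) (cong (iA * iA * iK * iK *_) H)))
      (RingSolver.solve (A ∷ K ∷ D ∷ D′ ∷ iA ∷ iK ∷ q ∷ []) ℚ-ring)

  D-rescaled : ∀ a K d M .{{_ : NonZero K}} .{{_ : NonZero M}} → M ≡ K ℕ.* d → Coprime ∣ a ∣ K →
               D ((+ d ℚ./ 1) * (a ℚ./ M)) ≡ s a K
  D-rescaled a K@(suc k) d M@(suc m) M≡Kd a⊥K = begin
    D ((+ d ℚ./ 1) * (a ℚ./ M))     ≡⟨ cong D (trans (/-* (+ d) 0 a m) (/-≡ (+ d ℤ.* a) (1 ℕ.* M) a K cross)) ⟩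
    D (a ℚ./ K)                     ≡⟨ cong D (ℚP.↥p/↧p≡p (mkℚ a k a⊥K)) ⟩
    D (mkℚ a k a⊥K)                 ≡⟨ D≡s a k a⊥K ⟩
    s a K                           ∎
    where
    open ≡-Reasoning
    cross : + d ℤ.* a ℤ.* + K ≡ a ℤ.* + (1 ℕ.* M)
    cross = begin
      + d ℤ.* a ℤ.* + K        ≡⟨ regroup (+ d) a (+ K) ⟩
      a ℤ.* (+ K ℤ.* + d)      ≡⟨ cong (a ℤ.*_) (ℤP.pos-* K d) ⟨
      a ℤ.* + (K ℕ.* d)        ≡⟨ cong (λ x → a ℤ.* + x) (trans (sym M≡Kd) (sym (ℕP.*-identityˡ M))) ⟩
      a ℤ.* + (1 ℕ.* M)        ∎
      where
      regroup : ∀ d a k → d ℤ.* a ℤ.* k ≡ a ℤ.* (k ℤ.* d)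
      regroup = solve-∀

module Signs where
  open import Data.Nat using (zero)
  open import Data.Integer as ℤ using (ℤ; +_; -[1+_]; +[1+_]; _+_; _*_; -_; _-_)
  import Data.Integer.Properties as ℤP
  open import Data.Product using (_×_; _,_)
  open import Data.Sum using (_⊎_; inj₁; inj₂)
  open import Function using (_∘_)
  open import Relation.Nullary using (Dec; yes; no; ¬_)
  open import Relation.Nullary.Decidable using (from-yes; _×-dec_; _→-dec_; _⊎-dec_; ¬?)
  open import Relation.Binary.PropositionalEquality

  data Sign₃ : Set where
    neg nil pos : Sign₃

  _≟₃_ : (σ τ : Sign₃) → Dec (σ ≡ τ)
  neg ≟₃ neg = yes refl
  neg ≟₃ nil = no λ ()
  neg ≟₃ pos = no λ ()
  nil ≟₃ neg = no λ ()
  nil ≟₃ nil = yes refl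
  nil ≟₃ pos = no λ ()
  pos ≟₃ neg = no λ ()
  pos ≟₃ nil = no λ ()
  pos ≟₃ pos = yes refl

  ∀₃? : {P : Sign₃ → Set} → (∀ σ → Dec (P σ)) → Dec (∀ σ → P σ)
  ∀₃? {P} P? with P? neg | P? nil | P? pos
  ... | yes Pneg | yes Pnil | yes Ppos = yes every
    where
    every : ∀ σ → P σ
    every neg = Pneg
    every nil = Pnil
    every pos = Ppos
  ... | no ¬Pneg | _        | _        = no λ ∀P → ¬Pneg (∀P neg)
  ... | yes _    | no ¬Pnil | _        = no λ ∀P → ¬Pnil (∀P nil)
  ... | yes _    | yes _    | no ¬Ppos = no λ ∀P → ¬Ppos (∀P pos)

  ⟦_⟧ : Sign₃ → ℤ
  ⟦ neg ⟧ = - + 1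
  ⟦ nil ⟧ = + 0
  ⟦ pos ⟧ = + 1

  _·₃_ : Sign₃ → Sign₃ → Sign₃
  nil ·₃ _   = nil
  _   ·₃ nil = nil
  pos ·₃ τ   = τ
  neg ·₃ neg = pos
  neg ·₃ pos = neg

  sign₃ : ℤ → Sign₃
  sign₃ (+ zero)  = nil
  sign₃ +[1+ _ ]  = pos
  sign₃ -[1+ _ ]  = neg

  sgn : ℤ → ℤ
  sgn x = ⟦ sign₃ x ⟧

  -- the signs u - v can have when u has sign σ and v has sign τ
  Possible : Sign₃ → Sign₃ → Sign₃ → Set
  Possible σ τ ρ = σ ≡ τ × σ ≢ nil ⊎ ρ ≡ sign₃ (⟦ σ ⟧ - ⟦ τ ⟧)

  sign₃-* : ∀ x y → sign₃ (x * y) ≡ sign₃ x ·₃ sign₃ y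
  sign₃-* (+ zero) y        = refl
  sign₃-* +[1+ m ] (+ zero) = cong sign₃ (ℤP.*-zeroʳ +[1+ m ])
  sign₃-* -[1+ m ] (+ zero) = cong sign₃ (ℤP.*-zeroʳ -[1+ m ])
  sign₃-* +[1+ m ] +[1+ n ] = refl
  sign₃-* +[1+ m ] -[1+ n ] = refl
  sign₃-* -[1+ m ] +[1+ n ] = refl
  sign₃-* -[1+ m ] -[1+ n ] = refl

  sign₃-- : ∀ u v → Possible (sign₃ u) (sign₃ v) (sign₃ (u - v))
  sign₃-- (+ zero) (+ zero) = inj₂ refl
  sign₃-- (+ zero) +[1+ n ] = inj₂ refl
  sign₃-- (+ zero) -[1+ n ] = inj₂ refl
  sign₃-- +[1+ m ] (+ zero) = inj₂ refl
  sign₃-- +[1+ m ] +[1+ n ] = inj₁ (refl , λ ())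
  sign₃-- +[1+ m ] -[1+ n ] = inj₂ refl
  sign₃-- -[1+ m ] (+ zero) = inj₂ refl
  sign₃-- -[1+ m ] +[1+ n ] = inj₂ refl
  sign₃-- -[1+ m ] -[1+ n ] = inj₁ (refl , λ ())

  sign₃-nil : ∀ {x} → sign₃ x ≡ nil → x ≡ + 0
  sign₃-nil {+ zero} _ = refl

  sign-table : ∀ α γ π κ ζ → α ≢ nil → ¬ (π ≡ nil × κ ≡ nil) → Possible (α ·₃ κ) (γ ·₃ π) ζ →
               ⟦ γ ⟧ * ⟦ ζ ⟧ * ⟦ κ ⟧ + ⟦ π ⟧ * ⟦ κ ⟧ ≡ ⟦ α ⟧ * ⟦ γ ⟧ + ⟦ α ⟧ * ⟦ ζ ⟧ * ⟦ π ⟧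
  sign-table = from-yes (∀₃? λ α → ∀₃? λ γ → ∀₃? λ π → ∀₃? λ κ → ∀₃? λ ζ →
    ¬? (α ≟₃ nil) →-dec ¬? ((π ≟₃ nil) ×-dec (κ ≟₃ nil)) →-dec possible? (α ·₃ κ) (γ ·₃ π) ζ →-dec
    (⟦ γ ⟧ * ⟦ ζ ⟧ * ⟦ κ ⟧ + ⟦ π ⟧ * ⟦ κ ⟧ ℤ.≟ ⟦ α ⟧ * ⟦ γ ⟧ + ⟦ α ⟧ * ⟦ ζ ⟧ * ⟦ π ⟧))
    where
    possible? : ∀ σ τ ρ → Dec (Possible σ τ ρ)
    possible? σ τ ρ = ((σ ≟₃ τ) ×-dec ¬? (σ ≟₃ nil)) ⊎-dec (ρ ≟₃ sign₃ (⟦ σ ⟧ - ⟦ τ ⟧))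

  sign-cocycle : ∀ α γ π κ → α ≢ + 0 → ¬ (π ≡ + 0 × κ ≡ + 0) →
                 let ζ = α * κ - γ * π in
                 sgn γ * sgn ζ * sgn κ + sgn π * sgn κ ≡ sgn α * sgn γ + sgn α * sgn ζ * sgn π
  sign-cocycle α γ π κ α≢0 ¬π≡0×κ≡0 = sign-table (sign₃ α) (sign₃ γ) (sign₃ π) (sign₃ κ) (sign₃ (α * κ - γ * π))
    (α≢0 ∘ sign₃-nil)
    (λ (π≡nil , κ≡nil) → ¬π≡0×κ≡0 (sign₃-nil π≡nil , sign₃-nil κ≡nil))
    (subst₂ (λ σ τ → Possible σ τ (sign₃ (α * κ - γ * π))) (sign₃-* α κ) (sign₃-* γ π) (sign₃-- (α * κ) (γ * π)))

  sgn-neg : ∀ x → sgn (- x) ≡ - sgn x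
  sgn-neg (+ zero) = refl
  sgn-neg +[1+ n ] = refl
  sgn-neg -[1+ n ] = refl

  sgn-*-pos : ∀ x e → sgn (x * +[1+ e ]) ≡ sgn x
  sgn-*-pos x e = cong ⟦_⟧ (trans (sign₃-* x +[1+ e ]) (·₃-pos (sign₃ x)))
    where
    ·₃-pos : ∀ σ → σ ·₃ pos ≡ σ
    ·₃-pos neg = refl
    ·₃-pos nil = refl
    ·₃-pos pos = refl

module Matrices where
  open import Data.Nat as ℕ using (ℕ; zero; suc)
  import Data.Nat.Properties as ℕP
  open import Data.Nat.Coprimality using (Coprime)
  open import Data.Nat.Divisibility using (∣1⇒≡1)
  open import Data.Integer as ℤ using (ℤ; +_; -[1+_]; +[1+_]; ∣_∣; _+_; _*_; -_; _-_)
  open import Data.Integer.DivMod using (a≡a%n+[a/n]*n; n%d<d)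
  import Data.Integer.Properties as ℤP
  open import Data.Integer.Divisibility.Signed using (_∣_; ∣ᵤ⇒∣; ∣⇒∣ᵤ; ∣m∣n⇒∣m-n; ∣m⇒∣m*n; ∣n⇒∣m*n)
  open import Data.Integer.Tactic.RingSolver using (solve-∀)
  open import Data.Product using (_×_; _,_)
  open import Data.Sum using (_⊎_; inj₁; inj₂)
  open import Relation.Nullary.Negation using (contradiction)
  open import Relation.Binary.PropositionalEquality

  det : Mat → ℤ
  det M = Mat.a M * Mat.d M - Mat.b M * Mat.c M

  T : ℤ → Mat
  T t = mat (+ 1) t (+ 0) (+ 1)

  S : Mat
  S = mat (+ 0) (- + 1) (+ 1) (+ 0)

  negate : Mat → Mat
  negate (mat a b c d) = mat (- a) (- b) (- c) (- d)

  mat-≡ : ∀ {a a′ b b′ c c′ d d′} → a ≡ a′ → b ≡ b′ → c ≡ c′ → d ≡ d′ → mat a b c d ≡ mat a′ b′ c′ d′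
  mat-≡ refl refl refl refl = refl

  T⊗ : ∀ t a b c d → T t ⊗ mat a b c d ≡ mat (a + t * c) (b + t * d) c d
  T⊗ t a b c d = mat-≡ (top t a c) (top t b d) (bottom a c) (bottom b d)
    where
    top : ∀ t x y → + 1 * x + t * y ≡ x + t * y
    top = solve-∀
    bottom : ∀ x y → + 0 * x + + 1 * y ≡ y
    bottom = solve-∀

  S⊗ : ∀ a b c d → S ⊗ mat a b c d ≡ mat (- c) (- d) a b
  S⊗ a b c d = mat-≡ (top a c) (top b d) (bottom a c) (bottom b d)
    where
    top : ∀ x y → + 0 * x + - + 1 * y ≡ - y
    top = solve-∀
    bottom : ∀ x y → + 1 * x + + 0 * y ≡ x
    bottom = solve-∀

  negate-⊗ : ∀ A B → negate A ⊗ B ≡ negate (A ⊗ B)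
  negate-⊗ (mat a b c d) (mat x y z w) = mat-≡ (entry a b x z) (entry a b y w) (entry c d x z) (entry c d y w)
    where
    entry : ∀ a b x z → - a * x + - b * z ≡ - (a * x + b * z)
    entry = solve-∀

  ⊗-assoc : ∀ A B C → (A ⊗ B) ⊗ C ≡ A ⊗ (B ⊗ C)
  ⊗-assoc (mat a₁ b₁ c₁ d₁) (mat a₂ b₂ c₂ d₂) (mat a₃ b₃ c₃ d₃) =
    mat-≡ (entry a₁ b₁ a₂ b₂ c₂ d₂ a₃ c₃) (entry a₁ b₁ a₂ b₂ c₂ d₂ b₃ d₃)
          (entry c₁ d₁ a₂ b₂ c₂ d₂ a₃ c₃) (entry c₁ d₁ a₂ b₂ c₂ d₂ b₃ d₃)
    where
    entry : ∀ p q r s t u v w → (p * r + q * t) * v + (p * s + q * u) * w ≡ p * (r * v + s * w) + q * (t * v + u * w)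
    entry = solve-∀

  det-⊗ : ∀ A B → det (A ⊗ B) ≡ det A * det B
  det-⊗ (mat a b c d) (mat x y z w) = product a b c d x y z w
    where
    product : ∀ a b c d x y z w → (a * x + b * z) * (c * y + d * w) - (a * y + b * w) * (c * x + d * z) ≡ (a * d - b * c) * (x * w - y * z)
    product = solve-∀

  unit-product : ∀ x y → x * y ≡ + 1 → x ≡ + 1 × y ≡ + 1 ⊎ x ≡ - + 1 × y ≡ - + 1
  unit-product +[1+ zero ]  y xy≡1 = inj₁ (refl , trans (sym (ℤP.*-identityˡ y)) xy≡1)
  unit-product -[1+ zero ]  y xy≡1 = inj₂ (refl , trans (sym (ℤP.neg-involutive y)) (cong -_ (trans (sym (ℤP.-1*i≡-i y)) xy≡1)))
  unit-product +[1+ suc m ] y xy≡1 =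
    contradiction (ℕP.m*n≡1⇒m≡1 (suc (suc m)) ∣ y ∣ (trans (sym (ℤP.abs-* +[1+ suc m ] y)) (cong ∣_∣ xy≡1))) λ ()
  unit-product -[1+ suc m ] y xy≡1 =
    contradiction (ℕP.m*n≡1⇒m≡1 (suc (suc m)) ∣ y ∣ (trans (sym (ℤP.abs-* -[1+ suc m ] y)) (cong ∣_∣ xy≡1))) λ ()

  det-upper : ∀ a b d → a * d - b * + 0 ≡ + 1 → a * d ≡ + 1
  det-upper a b d eq = trans (sym (drop a b d)) eq
    where
    drop : ∀ a b d → a * d - b * + 0 ≡ a * d
    drop = solve-∀

  det⇒coprime : ∀ a b c d → a * d - b * c ≡ + 1 → Coprime ∣ a ∣ ∣ c ∣
  det⇒coprime a b c d det≡1 {i} (i∣a , i∣c) =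
    ∣1⇒≡1 (∣⇒∣ᵤ (subst (+ i ∣_) det≡1
      (∣m∣n⇒∣m-n (∣m⇒∣m*n {+ i} {a} d (∣ᵤ⇒∣ i∣a)) (∣n⇒∣m*n {+ i} b {c} (∣ᵤ⇒∣ i∣c)))))

  c-T⊗ : ∀ t M → Mat.c (T t ⊗ M) ≡ Mat.c M
  c-T⊗ t (mat a b c d) = cong Mat.c (T⊗ t a b c d)

  c-S⊗ : ∀ M → Mat.c (S ⊗ M) ≡ Mat.a M
  c-S⊗ (mat a b c d) = cong Mat.c (S⊗ a b c d)

  det-S⊗ : ∀ M → det M ≡ + 1 → det (S ⊗ M) ≡ + 1
  det-S⊗ M detM≡1 = trans (det-⊗ S M) (cong (+ 1 *_) detM≡1)

  euclid-tail : (a b c d : ℤ) .{{_ : ℤ.NonZero c}} → Mat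
  euclid-tail a b c d = mat c d (- + (a ℤ.% c)) (- (b - a ℤ./ c * d))

  euclid-step : ∀ a b c d .{{_ : ℤ.NonZero c}} → mat a b c d ≡ T (a ℤ./ c) ⊗ (S ⊗ euclid-tail a b c d)
  euclid-step a b c d = sym (begin
    T t ⊗ (S ⊗ mat c d (- + r) (- (b - t * d)))         ≡⟨ cong (T t ⊗_) (S⊗ c d (- + r) (- (b - t * d))) ⟩
    T t ⊗ mat (- - + r) (- - (b - t * d)) c d           ≡⟨ T⊗ t (- - + r) (- - (b - t * d)) c d ⟩
    mat (- - + r + t * c) (- - (b - t * d) + t * d) c d ≡⟨ mat-≡ (trans (cong (_+ t * c) (ℤP.neg-involutive (+ r)))
                                                                       (sym (a≡a%n+[a/n]*n a c)))
                                                                (restore b t d) refl refl ⟩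
    mat a b c d                                         ∎)
    where
    open ≡-Reasoning
    t = a ℤ./ c
    r = a ℤ.% c
    restore : ∀ b t d → - - (b - t * d) + t * d ≡ b
    restore = solve-∀

  euclid-det : ∀ a b c d .{{_ : ℤ.NonZero c}} → a * d - b * c ≡ + 1 → det (euclid-tail a b c d) ≡ + 1
  euclid-det a b c d det≡1 =
    trans (expand (+ (a ℤ.% c)) (a ℤ./ c) b c d) (trans (cong (λ x → x * d - b * c) (sym (a≡a%n+[a/n]*n a c))) det≡1)
    where
    expand : ∀ r t b c d → c * - (b - t * d) - d * - r ≡ (r + t * c) * d - b * c
    expand = solve-∀

  euclid-decreasing : ∀ a b c d .{{_ : ℤ.NonZero c}} → ∣ Mat.c (euclid-tail a b c d) ∣ ℕ.< ∣ c ∣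
  euclid-decreasing a b c d = subst (ℕ._< ∣ c ∣) (sym (ℤP.∣-i∣≡∣i∣ (+ (a ℤ.% c)))) (n%d<d a c)

module Rademacher where
  open import Data.Nat using (zero; suc; _<_)
  import Data.Nat.Properties as ℕP
  open import Data.Integer as ℤ using (ℤ; +_; -[1+_]; +[1+_]; ∣_∣)
  import Data.Integer.Properties as ℤP
  open import Data.Integer.Tactic.RingSolver using (solve-∀)
  open import Data.Rational using (ℚ; 0ℚ; 1ℚ; _+_; _*_; _-_; -_)
  open import Data.List using (_∷_; [])
  open import Data.Product using (_×_; _,_)
  open import Data.Sum using (inj₁; inj₂)
  open import Relation.Nullary using (¬_)
  open import Relation.Nullary.Negation using (contradiction)
  open import Relation.Binary.PropositionalEquality
  import Tactic.RingSolver as RingSolver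
  open RationalArithmetic
  open DedekindSum
  open Signs
  open Matrices

  -- when c = 0 the determinant forces d = ±1, so b / d = b d
  Φ : Mat → ℚ
  Φ (mat a b (+ zero) d) = fromℤ (b ℤ.* d)
  Φ (mat a b +[1+ m ] d) = fromℤ (a ℤ.+ d) * 1/ℕ (suc m) - fromℤ (+ 12) * s a (suc m)
  Φ (mat a b -[1+ m ] d) = - (fromℤ (a ℤ.+ d) * 1/ℕ (suc m)) + fromℤ (+ 12) * s a (suc m)

  fromℤ-negate-+ : ∀ a d → fromℤ (ℤ.- a ℤ.+ ℤ.- d) ≡ - fromℤ (a ℤ.+ d)
  fromℤ-negate-+ a d = trans (cong fromℤ (sym (ℤP.neg-distrib-+ a d))) (fromℤ-neg (a ℤ.+ d))

  fromℤ-negate-+ˡ : ∀ n x → fromℤ (ℤ.- + n ℤ.+ x) ≡ - fromℤ (+ n) + fromℤ x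
  fromℤ-negate-+ˡ n x = trans (fromℤ-+ (ℤ.- + n) x) (cong (_+ fromℤ x) (fromℤ-neg (+ n)))

  Φ-negate : ∀ a b c d → Φ (mat (ℤ.- a) (ℤ.- b) (ℤ.- c) (ℤ.- d)) ≡ Φ (mat a b c d)
  Φ-negate a b (+ zero) d = cong fromℤ (negate² b d)
    where
    negate² : ∀ b d → ℤ.- b ℤ.* ℤ.- d ≡ b ℤ.* d
    negate² = solve-∀
  Φ-negate a b +[1+ m ] d = begin
    - (fromℤ (ℤ.- a ℤ.+ ℤ.- d) * 1/ℕ (suc m)) + fromℤ (+ 12) * s (ℤ.- a) (suc m)
      ≡⟨ cong₂ (λ x σ → - (x * 1/ℕ (suc m)) + fromℤ (+ 12) * σ) (fromℤ-negate-+ a d) (s-odd a (suc m)) ⟩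
    - (- fromℤ (a ℤ.+ d) * 1/ℕ (suc m)) + fromℤ (+ 12) * - s a (suc m)
      ≡⟨ negate² (fromℤ (a ℤ.+ d)) (1/ℕ (suc m)) (fromℤ (+ 12)) (s a (suc m)) ⟩
    fromℤ (a ℤ.+ d) * 1/ℕ (suc m) - fromℤ (+ 12) * s a (suc m) ∎
    where
    open ≡-Reasoning
    negate² : ∀ x i t σ → - (- x * i) + t * - σ ≡ x * i - t * σ
    negate² = RingSolver.solve-∀ ℚ-ring
  Φ-negate a b -[1+ m ] d = begin
    fromℤ (ℤ.- a ℤ.+ ℤ.- d) * 1/ℕ (suc m) - fromℤ (+ 12) * s (ℤ.- a) (suc m)
      ≡⟨ cong₂ (λ x σ → x * 1/ℕ (suc m) - fromℤ (+ 12) * σ) (fromℤ-negate-+ a d) (s-odd a (suc m)) ⟩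
    - fromℤ (a ℤ.+ d) * 1/ℕ (suc m) - fromℤ (+ 12) * - s a (suc m)
      ≡⟨ negate² (fromℤ (a ℤ.+ d)) (1/ℕ (suc m)) (fromℤ (+ 12)) (s a (suc m)) ⟩
    - (fromℤ (a ℤ.+ d) * 1/ℕ (suc m)) + fromℤ (+ 12) * s a (suc m) ∎
    where
    open ≡-Reasoning
    negate² : ∀ x i t σ → - x * i - t * - σ ≡ - (x * i) + t * σ
    negate² = RingSolver.solve-∀ ℚ-ring

  fromℤ-shift : ∀ a t c d → fromℤ (a ℤ.+ t ℤ.* c ℤ.+ d) ≡ fromℤ (a ℤ.+ d) + fromℤ t * fromℤ c
  fromℤ-shift a t c d =
    trans (cong fromℤ (regroup a t c d)) (trans (fromℤ-+ (a ℤ.+ d) (t ℤ.* c)) (cong (_+_ (fromℤ (a ℤ.+ d))) (fromℤ-* t c)))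
    where
    regroup : ∀ a t c d → a ℤ.+ t ℤ.* c ℤ.+ d ≡ a ℤ.+ d ℤ.+ t ℤ.* c
    regroup = solve-∀

  Φ-shift : ∀ a b c d t → a ℤ.* d ℤ.- b ℤ.* c ≡ + 1 →
            Φ (mat (a ℤ.+ t ℤ.* c) (b ℤ.+ t ℤ.* d) c d) ≡ Φ (mat a b c d) + fromℤ t
  Φ-shift a b (+ zero) d t det≡1 with unit-product a d (det-upper a b d det≡1)
  ... | inj₁ (refl , refl) = trans (cong fromℤ (shift b t)) (fromℤ-+ (b ℤ.* + 1) t)
    where
    shift : ∀ b t → (b ℤ.+ t ℤ.* + 1) ℤ.* + 1 ≡ b ℤ.* + 1 ℤ.+ t
    shift = solve-∀
  ... | inj₂ (refl , refl) = trans (cong fromℤ (shift b t)) (fromℤ-+ (b ℤ.* ℤ.- + 1) t)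
    where
    shift : ∀ b t → (b ℤ.+ t ℤ.* ℤ.- + 1) ℤ.* ℤ.- + 1 ≡ b ℤ.* ℤ.- + 1 ℤ.+ t
    shift = solve-∀
  Φ-shift a b +[1+ m ] d t _ = begin
    fromℤ (a ℤ.+ t ℤ.* + C ℤ.+ d) * 1/ℕ C - fromℤ (+ 12) * s (a ℤ.+ t ℤ.* + C) C
      ≡⟨ cong₂ (λ x σ → x * 1/ℕ C - fromℤ (+ 12) * σ) (fromℤ-shift a t (+ C) d) (s-periodic a t C) ⟩
    (fromℤ (a ℤ.+ d) + fromℤ t * fromℤ (+ C)) * 1/ℕ C - fromℤ (+ 12) * s a C
      ≡⟨ algebra (fromℤ (a ℤ.+ d)) (fromℤ t) (fromℤ (+ C)) (1/ℕ C) (fromℤ (+ 12) * s a C) (fromℤ*1/ℕ C) ⟩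
    fromℤ (a ℤ.+ d) * 1/ℕ C - fromℤ (+ 12) * s a C + fromℤ t ∎
    where
    open ≡-Reasoning
    C = suc m
    algebra : ∀ x t c i σ → c * i ≡ 1ℚ → (x + t * c) * i - σ ≡ x * i - σ + t
    algebra x t c i σ ci≡1 = linear-combinationℚ (cong (t *_) ci≡1) (RingSolver.solve (x ∷ t ∷ c ∷ i ∷ σ ∷ []) ℚ-ring)
  Φ-shift a b -[1+ m ] d t _ = begin
    - (fromℤ (a ℤ.+ t ℤ.* -[1+ m ] ℤ.+ d) * 1/ℕ C) + fromℤ (+ 12) * s (a ℤ.+ t ℤ.* -[1+ m ]) C
      ≡⟨ cong₂ (λ x σ → - (x * 1/ℕ C) + fromℤ (+ 12) * σ)
               (trans (fromℤ-shift a t (ℤ.- + C) d) (cong (λ c → fromℤ (a ℤ.+ d) + fromℤ t * c) (fromℤ-neg (+ C))))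
               (trans (cong (λ x → s x C) (move-sign a t (+ C))) (s-periodic a (ℤ.- t) C)) ⟩
    - ((fromℤ (a ℤ.+ d) + fromℤ t * - fromℤ (+ C)) * 1/ℕ C) + fromℤ (+ 12) * s a C
      ≡⟨ algebra (fromℤ (a ℤ.+ d)) (fromℤ t) (fromℤ (+ C)) (1/ℕ C) (fromℤ (+ 12) * s a C) (fromℤ*1/ℕ C) ⟩
    - (fromℤ (a ℤ.+ d) * 1/ℕ C) + fromℤ (+ 12) * s a C + fromℤ t ∎
    where
    open ≡-Reasoning
    C = suc m
    move-sign : ∀ a t c → a ℤ.+ t ℤ.* ℤ.- c ≡ a ℤ.+ ℤ.- t ℤ.* c
    move-sign = solve-∀
    algebra : ∀ x t c i σ → c * i ≡ 1ℚ → - ((x + t * - c) * i) + σ ≡ - (x * i) + σ + t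
    algebra x t c i σ ci≡1 = linear-combinationℚ (cong (t *_) ci≡1) (RingSolver.solve (x ∷ t ∷ c ∷ i ∷ σ ∷ []) ℚ-ring)

  fromℤ-det : ∀ a b c d → a ℤ.* d ℤ.- b ℤ.* c ≡ + 1 → fromℤ a * fromℤ d - fromℤ b * fromℤ c ≡ 1ℚ
  fromℤ-det a b c d det≡1 = begin
    fromℤ a * fromℤ d - fromℤ b * fromℤ c   ≡⟨ cong₂ _-_ (fromℤ-* a d) (fromℤ-* b c) ⟨
    fromℤ (a ℤ.* d) - fromℤ (b ℤ.* c)       ≡⟨ fromℤ-- (a ℤ.* d) (b ℤ.* c) ⟨
    fromℤ (a ℤ.* d ℤ.- b ℤ.* c)             ≡⟨ cong fromℤ det≡1 ⟩
    1ℚ                                      ∎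
    where open ≡-Reasoning

  Φ-flip-pos : ∀ a b γ d → a ℤ.* d ℤ.- b ℤ.* +[1+ γ ] ≡ + 1 →
               Φ (mat -[1+ γ ] (ℤ.- d) a b) ≡ Φ (mat a b +[1+ γ ] d) - fromℤ (+ 3 ℤ.* sgn a ℤ.* + 1)
  Φ-flip-pos (+ zero) b γ d det≡1 with unit-product b -[1+ γ ] (trans (negate-right b +[1+ γ ] d) det≡1)
    where
    negate-right : ∀ b c d → b ℤ.* ℤ.- c ≡ + 0 ℤ.* d ℤ.- b ℤ.* c
    negate-right = solve-∀
  ... | inj₂ (refl , refl) = begin
    fromℤ (ℤ.- d ℤ.* ℤ.- + 1)
      ≡⟨ cong fromℤ (negate² d) ⟩
    fromℤ (+ 0 ℤ.+ d)
      ≡⟨ algebra (fromℤ (+ 0 ℤ.+ d)) (fromℤ (+ 12)) ⟩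
    fromℤ (+ 0 ℤ.+ d) * 1ℚ - fromℤ (+ 12) * 0ℚ - 0ℚ
      ≡⟨ cong (λ σ → fromℤ (+ 0 ℤ.+ d) * 1ℚ - fromℤ (+ 12) * σ - 0ℚ) (s-1 (+ 0)) ⟨
    fromℤ (+ 0 ℤ.+ d) * 1/ℕ 1 - fromℤ (+ 12) * s (+ 0) 1 - fromℤ (+ 0) ∎
    where
    open ≡-Reasoning
    negate² : ∀ d → ℤ.- d ℤ.* ℤ.- + 1 ≡ + 0 ℤ.+ d
    negate² = solve-∀
    algebra : ∀ x t → x ≡ x * 1ℚ - t * 0ℚ - 0ℚ
    algebra = RingSolver.solve-∀ ℚ-ring
  Φ-flip-pos +[1+ α ] b γ d det≡1 = begin
    fromℤ (-[1+ γ ] ℤ.+ b) * 1/ℕ A - fromℤ (+ 12) * s -[1+ γ ] A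
      ≡⟨ cong₂ (λ x σ → x * 1/ℕ A - fromℤ (+ 12) * σ) (fromℤ-negate-+ˡ C b) (s-odd (+ C) A) ⟩
    (- fromℤ (+ C) + fromℤ b) * 1/ℕ A - fromℤ (+ 12) * - s (+ C) A
      ≡⟨ algebra (fromℤ (+ A)) (fromℤ (+ C)) (fromℤ b) (fromℤ d) (1/ℕ A) (1/ℕ C) (s (+ A) C) (s (+ C) A)
          (fromℤ*1/ℕ A) (fromℤ*1/ℕ C) (fromℤ-det (+ A) b (+ C) d det≡1) (s-reciprocity A C (det⇒coprime (+ A) b (+ C) d det≡1)) ⟩
    (fromℤ (+ A) + fromℤ d) * 1/ℕ C - fromℤ (+ 12) * s (+ A) C - fromℤ (+ 3)
      ≡⟨ cong (λ x → x * 1/ℕ C - fromℤ (+ 12) * s (+ A) C - fromℤ (+ 3)) (fromℤ-+ (+ A) d) ⟨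
    fromℤ (+ A ℤ.+ d) * 1/ℕ C - fromℤ (+ 12) * s (+ A) C - fromℤ (+ 3) ∎
    where
    open ≡-Reasoning
    A = suc α
    C = suc γ
    algebra : ∀ A C B D iA iC sAC sCA → A * iA ≡ 1ℚ → C * iC ≡ 1ℚ → A * D - B * C ≡ 1ℚ →
              fromℤ (+ 12) * (sAC + sCA) ≡ (A * A + C * C + 1ℚ) * (iA * iC) - fromℤ (+ 3) →
              (- C + B) * iA - fromℤ (+ 12) * - sCA ≡ (A + D) * iC - fromℤ (+ 12) * sAC - fromℤ (+ 3)
    algebra A C B D iA iC sAC sCA AiA≡1 CiC≡1 det≡1 reciprocity = linear-combinationℚ
      (cong₂ _+_ (cong₂ _+_ reciprocity (cong ((A * iC + D * iC) *_) AiA≡1))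
                 (cong₂ _+_ (cong ((C * iA - B * iA) *_) CiC≡1) (cong (- (iA * iC) *_) det≡1)))
      (RingSolver.solve (A ∷ C ∷ B ∷ D ∷ iA ∷ iC ∷ sAC ∷ sCA ∷ []) ℚ-ring)
  Φ-flip-pos -[1+ α ] b γ d det≡1 = begin
    - (fromℤ (-[1+ γ ] ℤ.+ b) * 1/ℕ A) + fromℤ (+ 12) * s -[1+ γ ] A
      ≡⟨ cong₂ (λ x σ → - (x * 1/ℕ A) + fromℤ (+ 12) * σ) (fromℤ-negate-+ˡ C b) (s-odd (+ C) A) ⟩
    - ((- fromℤ (+ C) + fromℤ b) * 1/ℕ A) + fromℤ (+ 12) * - s (+ C) A
      ≡⟨ algebra (fromℤ (+ A)) (fromℤ (+ C)) (fromℤ b) (fromℤ d) (1/ℕ A) (1/ℕ C) (s (+ A) C) (s (+ C) A)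
          (fromℤ*1/ℕ A) (fromℤ*1/ℕ C)
          (trans (cong (λ x → x * fromℤ d - fromℤ b * fromℤ (+ C)) (sym (fromℤ-neg (+ A)))) (fromℤ-det (ℤ.- + A) b (+ C) d det≡1))
          (s-reciprocity A C (det⇒coprime (ℤ.- + A) b (+ C) d det≡1)) ⟩
    (- fromℤ (+ A) + fromℤ d) * 1/ℕ C - fromℤ (+ 12) * - s (+ A) C - - fromℤ (+ 3)
      ≡⟨ cong₂ (λ x σ → x * 1/ℕ C - fromℤ (+ 12) * σ - - fromℤ (+ 3)) (fromℤ-negate-+ˡ A d) (s-odd (+ A) C) ⟨
    fromℤ (-[1+ α ] ℤ.+ d) * 1/ℕ C - fromℤ (+ 12) * s -[1+ α ] C - - fromℤ (+ 3) ∎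
    where
    open ≡-Reasoning
    A = suc α
    C = suc γ
    algebra : ∀ A C B D iA iC sAC sCA → A * iA ≡ 1ℚ → C * iC ≡ 1ℚ → - A * D - B * C ≡ 1ℚ →
              fromℤ (+ 12) * (sAC + sCA) ≡ (A * A + C * C + 1ℚ) * (iA * iC) - fromℤ (+ 3) →
              - ((- C + B) * iA) + fromℤ (+ 12) * - sCA ≡ (- A + D) * iC - fromℤ (+ 12) * - sAC - - fromℤ (+ 3)
    algebra A C B D iA iC sAC sCA AiA≡1 CiC≡1 det≡1 reciprocity = linear-combinationℚ
      (cong₂ _+_ (cong₂ _+_ (cong (- 1ℚ *_) reciprocity) (cong ((- (A * iC) + D * iC) *_) AiA≡1))
                 (cong₂ _+_ (cong ((- (C * iA) + B * iA) *_) CiC≡1) (cong (iA * iC *_) det≡1)))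
      (RingSolver.solve (A ∷ C ∷ B ∷ D ∷ iA ∷ iC ∷ sAC ∷ sCA ∷ []) ℚ-ring)

  Φ-flip : ∀ a b c d → a ℤ.* d ℤ.- b ℤ.* c ≡ + 1 →
           Φ (mat (ℤ.- c) (ℤ.- d) a b) ≡ Φ (mat a b c d) - fromℤ (+ 3 ℤ.* sgn a ℤ.* sgn c)
  Φ-flip a b (+ zero) d det≡1 with unit-product a d (det-upper a b d det≡1)
  ... | inj₁ (refl , refl) = begin
    fromℤ (+ 0 ℤ.+ b) * 1ℚ - fromℤ (+ 12) * s (+ 0) 1
      ≡⟨ cong₂ (λ x σ → x * 1ℚ - fromℤ (+ 12) * σ) (cong fromℤ (ℤP.+-identityˡ b)) (s-1 (+ 0)) ⟩
    fromℤ b * 1ℚ - fromℤ (+ 12) * 0ℚ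
      ≡⟨ algebra (fromℤ b) (fromℤ (+ 12)) ⟩
    fromℤ b - 0ℚ
      ≡⟨ cong (λ x → fromℤ x - 0ℚ) (ℤP.*-identityʳ b) ⟨
    fromℤ (b ℤ.* + 1) - 0ℚ ∎
    where
    open ≡-Reasoning
    algebra : ∀ x t → x * 1ℚ - t * 0ℚ ≡ x - 0ℚ
    algebra = RingSolver.solve-∀ ℚ-ring
  ... | inj₂ (refl , refl) = begin
    - (fromℤ (+ 0 ℤ.+ b) * 1ℚ) + fromℤ (+ 12) * s (+ 0) 1
      ≡⟨ cong₂ (λ x σ → - (x * 1ℚ) + fromℤ (+ 12) * σ) (cong fromℤ (ℤP.+-identityˡ b)) (s-1 (+ 0)) ⟩
    - (fromℤ b * 1ℚ) + fromℤ (+ 12) * 0ℚ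
      ≡⟨ algebra (fromℤ b) (fromℤ (+ 12)) ⟩
    - fromℤ b - 0ℚ
      ≡⟨ cong (_- 0ℚ) (fromℤ-neg b) ⟨
    fromℤ (ℤ.- b) - 0ℚ
      ≡⟨ cong (λ x → fromℤ x - 0ℚ) (ℤP.-1*i≡-i b) ⟨
    fromℤ (ℤ.- + 1 ℤ.* b) - 0ℚ
      ≡⟨ cong (λ x → fromℤ x - 0ℚ) (ℤP.*-comm (ℤ.- + 1) b) ⟩
    fromℤ (b ℤ.* ℤ.- + 1) - 0ℚ ∎
    where
    open ≡-Reasoning
    algebra : ∀ x t → - (x * 1ℚ) + t * 0ℚ ≡ - x - 0ℚ
    algebra = RingSolver.solve-∀ ℚ-ring
  Φ-flip a b +[1+ γ ] d det≡1 = Φ-flip-pos a b γ d det≡1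
  Φ-flip a b -[1+ γ ] d det≡1 = begin
    Φ (mat +[1+ γ ] (ℤ.- d) a b)
      ≡⟨ cong₂ (λ x y → Φ (mat +[1+ γ ] (ℤ.- d) x y)) (ℤP.neg-involutive a) (ℤP.neg-involutive b) ⟨
    Φ (mat +[1+ γ ] (ℤ.- d) (ℤ.- (ℤ.- a)) (ℤ.- (ℤ.- b)))
      ≡⟨ Φ-negate -[1+ γ ] d (ℤ.- a) (ℤ.- b) ⟩
    Φ (mat -[1+ γ ] d (ℤ.- a) (ℤ.- b))
      ≡⟨ cong (λ x → Φ (mat -[1+ γ ] x (ℤ.- a) (ℤ.- b))) (ℤP.neg-involutive d) ⟨
    Φ (mat -[1+ γ ] (ℤ.- (ℤ.- d)) (ℤ.- a) (ℤ.- b))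
      ≡⟨ Φ-flip-pos (ℤ.- a) (ℤ.- b) γ (ℤ.- d) (trans (negate-det a b (+ suc γ) d) det≡1) ⟩
    Φ (mat (ℤ.- a) (ℤ.- b) +[1+ γ ] (ℤ.- d)) - fromℤ (+ 3 ℤ.* sgn (ℤ.- a) ℤ.* + 1)
      ≡⟨ cong₂ _-_ (Φ-negate a b -[1+ γ ] d)
                   (cong fromℤ (trans (cong (λ σ → + 3 ℤ.* σ ℤ.* + 1) (sgn-neg a)) (move-sign (sgn a)))) ⟩
    Φ (mat a b -[1+ γ ] d) - fromℤ (+ 3 ℤ.* sgn a ℤ.* ℤ.- + 1) ∎
    where
    open ≡-Reasoning
    negate-det : ∀ a b c d → ℤ.- a ℤ.* ℤ.- d ℤ.- ℤ.- b ℤ.* c ≡ a ℤ.* d ℤ.- b ℤ.* ℤ.- c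
    negate-det = solve-∀
    move-sign : ∀ σ → + 3 ℤ.* ℤ.- σ ℤ.* + 1 ≡ + 3 ℤ.* σ ℤ.* ℤ.- + 1
    move-sign = solve-∀

  Φ-negateₘ : ∀ M → Φ (negate M) ≡ Φ M
  Φ-negateₘ (mat a b c d) = Φ-negate a b c d

  Φ-T : ∀ t M → det M ≡ + 1 → Φ (T t ⊗ M) ≡ Φ M + fromℤ t
  Φ-T t (mat a b c d) det≡1 = trans (cong Φ (T⊗ t a b c d)) (Φ-shift a b c d t det≡1)

  Φ-S : ∀ M → det M ≡ + 1 → Φ (S ⊗ M) ≡ Φ M - fromℤ (+ 3 ℤ.* sgn (Mat.a M) ℤ.* sgn (Mat.c M))
  Φ-S (mat a b c d) det≡1 = trans (cong Φ (S⊗ a b c d)) (Φ-flip a b c d det≡1)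

  sign-correction : Mat → Mat → ℤ
  sign-correction A B = + 3 ℤ.* sgn (Mat.c A) ℤ.* sgn (Mat.c B) ℤ.* sgn (Mat.c (A ⊗ B))

  sign-correction-step : ∀ t A′ B → det A′ ≡ + 1 → det B ≡ + 1 → Mat.a A′ ≢ + 0 →
    let P = A′ ⊗ B in
    sign-correction A′ B ℤ.+ + 3 ℤ.* sgn (Mat.a P) ℤ.* sgn (Mat.c P)
    ≡ + 3 ℤ.* sgn (Mat.a A′) ℤ.* sgn (Mat.c A′) ℤ.+ sign-correction (T t ⊗ (S ⊗ A′)) B
  sign-correction-step t A′@(mat a′ b′ c′ d′) B@(mat x y z w) detA′ detB a′≢0 = begin
    + 3 ℤ.* sgn c′ ℤ.* sgn z ℤ.* sgn (Mat.c P) ℤ.+ + 3 ℤ.* sgn (Mat.a P) ℤ.* sgn (Mat.c P)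
      ≡⟨ factor (sgn c′) (sgn z) (sgn (Mat.c P)) (sgn (Mat.a P)) ⟩
    + 3 ℤ.* (sgn c′ ℤ.* sgn z ℤ.* sgn (Mat.c P) ℤ.+ sgn (Mat.a P) ℤ.* sgn (Mat.c P))
      ≡⟨ cong (+ 3 ℤ.*_) (subst (λ ζ → sgn c′ ℤ.* sgn ζ ℤ.* sgn (Mat.c P) ℤ.+ sgn (Mat.a P) ℤ.* sgn (Mat.c P)
                                      ≡ sgn a′ ℤ.* sgn c′ ℤ.+ sgn a′ ℤ.* sgn ζ ℤ.* sgn (Mat.a P))
                                 z≡ (sign-cocycle a′ c′ (Mat.a P) (Mat.c P) a′≢0 column≢0)) ⟩
    + 3 ℤ.* (sgn a′ ℤ.* sgn c′ ℤ.+ sgn a′ ℤ.* sgn z ℤ.* sgn (Mat.a P))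
      ≡⟨ distribute (sgn a′) (sgn c′) (sgn z) (sgn (Mat.a P)) ⟩
    + 3 ℤ.* sgn a′ ℤ.* sgn c′ ℤ.+ + 3 ℤ.* sgn a′ ℤ.* sgn z ℤ.* sgn (Mat.a P)
      ≡⟨ cong₂ (λ α π → + 3 ℤ.* sgn a′ ℤ.* sgn c′ ℤ.+ + 3 ℤ.* sgn α ℤ.* sgn z ℤ.* sgn π) c-A c-AB ⟨
    + 3 ℤ.* sgn a′ ℤ.* sgn c′ ℤ.+ sign-correction A B ∎
    where
    open ≡-Reasoning
    A = T t ⊗ (S ⊗ A′)
    P = A′ ⊗ B
    c-A : Mat.c A ≡ a′
    c-A = trans (c-T⊗ t (S ⊗ A′)) (c-S⊗ A′)
    c-AB : Mat.c (A ⊗ B) ≡ Mat.a P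
    c-AB = trans (cong Mat.c (⊗-assoc (T t) (S ⊗ A′) B))
                 (trans (c-T⊗ t ((S ⊗ A′) ⊗ B)) (trans (cong Mat.c (⊗-assoc S A′ B)) (c-S⊗ P)))
    column≢0 : ¬ (Mat.a P ≡ + 0 × Mat.c P ≡ + 0)
    column≢0 (aP≡0 , cP≡0) = contradiction (begin
      + 1                                           ≡⟨ trans (det-⊗ A′ B) (cong₂ ℤ._*_ detA′ detB) ⟨
      Mat.a P ℤ.* Mat.d P ℤ.- Mat.b P ℤ.* Mat.c P   ≡⟨ cong₂ (λ α γ → α ℤ.* Mat.d P ℤ.- Mat.b P ℤ.* γ) aP≡0 cP≡0 ⟩
      + 0 ℤ.* Mat.d P ℤ.- Mat.b P ℤ.* + 0           ≡⟨ vanish (Mat.b P) (Mat.d P) ⟩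
      + 0                                           ∎) λ ()
      where
      vanish : ∀ b d → + 0 ℤ.* d ℤ.- b ℤ.* + 0 ≡ + 0
      vanish = solve-∀
    z≡ : a′ ℤ.* Mat.c P ℤ.- c′ ℤ.* Mat.a P ≡ z
    z≡ = trans (expand a′ b′ c′ d′ x z) (trans (cong (ℤ._* z) detA′) (ℤP.*-identityˡ z))
      where
      expand : ∀ a′ b′ c′ d′ x z → a′ ℤ.* (c′ ℤ.* x ℤ.+ d′ ℤ.* z) ℤ.- c′ ℤ.* (a′ ℤ.* x ℤ.+ b′ ℤ.* z)
                                   ≡ (a′ ℤ.* d′ ℤ.- b′ ℤ.* c′) ℤ.* z
      expand = solve-∀
    factor : ∀ p q r s → + 3 ℤ.* p ℤ.* q ℤ.* r ℤ.+ + 3 ℤ.* s ℤ.* r ≡ + 3 ℤ.* (p ℤ.* q ℤ.* r ℤ.+ s ℤ.* r)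
    factor = solve-∀
    distribute : ∀ α γ ζ π → + 3 ℤ.* (α ℤ.* γ ℤ.+ α ℤ.* ζ ℤ.* π) ≡ + 3 ℤ.* α ℤ.* γ ℤ.+ + 3 ℤ.* α ℤ.* ζ ℤ.* π
    distribute = solve-∀

  Φ-cocycle-step : ∀ t A′ B → det A′ ≡ + 1 → det B ≡ + 1 → Mat.a A′ ≢ + 0 →
                   Φ (A′ ⊗ B) ≡ Φ A′ + Φ B - fromℤ (sign-correction A′ B) →
                   let A = T t ⊗ (S ⊗ A′) in Φ (A ⊗ B) ≡ Φ A + Φ B - fromℤ (sign-correction A B)
  Φ-cocycle-step t A′ B detA′ detB a′≢0 IH = begin
    Φ (A ⊗ B)
      ≡⟨ cong Φ (trans (⊗-assoc (T t) (S ⊗ A′) B) (cong (T t ⊗_) (⊗-assoc S A′ B))) ⟩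
    Φ (T t ⊗ (S ⊗ P))
      ≡⟨ Φ-T t (S ⊗ P) (det-S⊗ P detP) ⟩
    Φ (S ⊗ P) + fromℤ t
      ≡⟨ cong (_+ fromℤ t) (Φ-S P detP) ⟩
    Φ P - fromℤ e₁ + fromℤ t
      ≡⟨ cong (λ φ → φ - fromℤ e₁ + fromℤ t) IH ⟩
    Φ A′ + Φ B - fromℤ σ′ - fromℤ e₁ + fromℤ t
      ≡⟨ algebra (Φ A′) (Φ B) (fromℤ t) (fromℤ σ′) (fromℤ e₁) (fromℤ e₂) (fromℤ σ) signs ⟩
    Φ A′ - fromℤ e₂ + fromℤ t + Φ B - fromℤ σ
      ≡⟨ cong (λ φ → φ + Φ B - fromℤ σ) ΦA ⟨
    Φ A + Φ B - fromℤ σ ∎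
    where
    open ≡-Reasoning
    A = T t ⊗ (S ⊗ A′)
    P = A′ ⊗ B
    σ = sign-correction A B
    σ′ = sign-correction A′ B
    e₁ = + 3 ℤ.* sgn (Mat.a P) ℤ.* sgn (Mat.c P)
    e₂ = + 3 ℤ.* sgn (Mat.a A′) ℤ.* sgn (Mat.c A′)
    detP : det P ≡ + 1
    detP = trans (det-⊗ A′ B) (cong₂ ℤ._*_ detA′ detB)
    ΦA : Φ A ≡ Φ A′ - fromℤ e₂ + fromℤ t
    ΦA = trans (Φ-T t (S ⊗ A′) (det-S⊗ A′ detA′)) (cong (_+ fromℤ t) (Φ-S A′ detA′))
    signs : fromℤ σ′ + fromℤ e₁ ≡ fromℤ e₂ + fromℤ σ
    signs = trans (sym (fromℤ-+ σ′ e₁)) (trans (cong fromℤ (sign-correction-step t A′ B detA′ detB a′≢0)) (fromℤ-+ e₂ σ))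
    algebra : ∀ φ′ φ t σ′ e₁ e₂ σ → σ′ + e₁ ≡ e₂ + σ → φ′ + φ - σ′ - e₁ + t ≡ φ′ - e₂ + t + φ - σ
    algebra φ′ φ t σ′ e₁ e₂ σ eq =
      linear-combinationℚ (cong (- 1ℚ *_) eq) (RingSolver.solve (φ′ ∷ φ ∷ t ∷ σ′ ∷ e₁ ∷ e₂ ∷ σ ∷ []) ℚ-ring)

  Φ-cocycle : ∀ A B → det A ≡ + 1 → det B ≡ + 1 → Φ (A ⊗ B) ≡ Φ A + Φ B - fromℤ (sign-correction A B)
  Φ-cocycle A B = bounded (suc ∣ Mat.c A ∣) A (ℕP.n<1+n _)
    where
    Cocycle : Mat → Set
    Cocycle A = Φ (A ⊗ B) ≡ Φ A + Φ B - fromℤ (sign-correction A B)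
    nonzero : ∀ n a b c d .{{_ : ℤ.NonZero c}} → c ≢ + 0 → ∣ c ∣ < suc n → a ℤ.* d ℤ.- b ℤ.* c ≡ + 1 → det B ≡ + 1 →
              (∀ A′ → ∣ Mat.c A′ ∣ < n → det A′ ≡ + 1 → det B ≡ + 1 → Cocycle A′) → Cocycle (mat a b c d)
    nonzero n a b c d c≢0 c<1+n detA detB IH = subst Cocycle (sym (euclid-step a b c d))
      (Φ-cocycle-step (a ℤ./ c) A′ B detA′ detB c≢0
        (IH A′ (ℕP.<-≤-trans (euclid-decreasing a b c d) (ℕP.≤-pred c<1+n)) detA′ detB))
      where
      A′ = euclid-tail a b c d
      detA′ = euclid-det a b c d detA
    bounded : ∀ n A → ∣ Mat.c A ∣ < n → det A ≡ + 1 → det B ≡ + 1 → Cocycle A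
    bounded (suc n) (mat a b (+ zero) d) _ detA detB with unit-product a d (det-upper a b d detA)
    ... | inj₁ (refl , refl) = begin
      Φ (T b ⊗ B)                          ≡⟨ Φ-T b B detB ⟩
      Φ B + fromℤ b                        ≡⟨ algebra (Φ B) (fromℤ b) ⟩
      fromℤ b + Φ B - 0ℚ                   ≡⟨ cong (λ x → fromℤ x + Φ B - 0ℚ) (ℤP.*-identityʳ b) ⟨
      fromℤ (b ℤ.* + 1) + Φ B - 0ℚ         ∎
      where
      open ≡-Reasoning
      algebra : ∀ φ x → φ + x ≡ x + φ - 0ℚ
      algebra = RingSolver.solve-∀ ℚ-ring
    ... | inj₂ (refl , refl) = begin
      Φ (mat (ℤ.- + 1) b (+ 0) (ℤ.- + 1) ⊗ B)
        ≡⟨ cong (λ x → Φ (mat (ℤ.- + 1) x (+ 0) (ℤ.- + 1) ⊗ B)) (ℤP.neg-involutive b) ⟨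
      Φ (negate (T (ℤ.- b)) ⊗ B)
        ≡⟨ cong Φ (negate-⊗ (T (ℤ.- b)) B) ⟩
      Φ (negate (T (ℤ.- b) ⊗ B))
        ≡⟨ Φ-negateₘ (T (ℤ.- b) ⊗ B) ⟩
      Φ (T (ℤ.- b) ⊗ B)
        ≡⟨ Φ-T (ℤ.- b) B detB ⟩
      Φ B + fromℤ (ℤ.- b)
        ≡⟨ cong (_+_ (Φ B)) (fromℤ-neg b) ⟩
      Φ B + - fromℤ b
        ≡⟨ algebra (Φ B) (fromℤ b) ⟩
      - fromℤ b + Φ B - 0ℚ
        ≡⟨ cong (λ x → x + Φ B - 0ℚ) (trans (cong fromℤ (trans (ℤP.*-comm b (ℤ.- + 1)) (ℤP.-1*i≡-i b))) (fromℤ-neg b)) ⟨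
      fromℤ (b ℤ.* ℤ.- + 1) + Φ B - 0ℚ ∎
      where
      open ≡-Reasoning
      algebra : ∀ φ x → φ + - x ≡ - x + φ - 0ℚ
      algebra = RingSolver.solve-∀ ℚ-ring
    bounded (suc n) (mat a b c@(+[1+ _ ]) d) c<1+n detA detB = nonzero n a b c d (λ ()) c<1+n detA detB (bounded n)
    bounded (suc n) (mat a b c@(-[1+ _ ]) d) c<1+n detA detB = nonzero n a b c d (λ ()) c<1+n detA detB (bounded n)

module DivisorSums where
  open import Data.Nat as ℕ using (ℕ; zero; suc; NonZero)
  import Data.Nat.Properties as ℕP
  open import Data.Nat.DivMod using (m/n*n≡m)
  open import Data.Nat.Divisibility as ℕD using (_∣?_; divides)
  open import Data.Nat.Coprimality using (Coprime)
  open import Data.Integer as ℤ using (ℤ; +_; -[1+_]; +[1+_]; ∣_∣)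
  import Data.Integer.Properties as ℤP
  open import Data.Integer.Tactic.RingSolver using (solve-∀)
  open import Data.Rational as ℚ using (ℚ; 0ℚ; _+_; _*_; _-_; -_)
  import Data.Rational.Properties as ℚP
  open import Data.List using (List; []; _∷_; map; upTo)
  open import Data.List.Relation.Unary.All using (All; []; _∷_)
  open import Data.List.Relation.Unary.All.Properties using (all-filter)
  open import Data.Product using (_×_; _,_; proj₁; proj₂)
  open import Relation.Nullary.Negation using (contradiction)
  open import Relation.Binary.PropositionalEquality
  import Tactic.RingSolver as RingSolver
  open RationalArithmetic
  open DedekindSum
  open Signs
  open Matrices
  open Rademacher

  sumℚ-cong : ∀ {P : ℕ → Set} {f g : ℕ → ℚ} (L : List ℕ) → All P L → (∀ {d} → P d → f d ≡ g d) →
              sumℚ (map f L) ≡ sumℚ (map g L)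
  sumℚ-cong []      []         f≡g = refl
  sumℚ-cong (d ∷ L) (Pd ∷ PL) f≡g = cong₂ _+_ (f≡g Pd) (sumℚ-cong L PL f≡g)

  sumℚ-+ : ∀ (f g : ℕ → ℚ) L → sumℚ (map (λ d → f d + g d) L) ≡ sumℚ (map f L) + sumℚ (map g L)
  sumℚ-+ f g []      = refl
  sumℚ-+ f g (d ∷ L) = trans (cong (_+_ (f d + g d)) (sumℚ-+ f g L)) (interchange (f d) (g d) (sumℚ (map f L)) (sumℚ (map g L)))
    where
    interchange : ∀ a b c d → a + b + (c + d) ≡ a + c + (b + d)
    interchange = RingSolver.solve-∀ ℚ-ring

  sumℚ-*ˡ : ∀ c (f : ℕ → ℚ) L → sumℚ (map (λ d → c * f d) L) ≡ c * sumℚ (map f L)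
  sumℚ-*ˡ c f []      = sym (ℚP.*-zeroʳ c)
  sumℚ-*ˡ c f (d ∷ L) = trans (cong (_+_ (c * f d)) (sumℚ-*ˡ c f L)) (sym (ℚP.*-distribˡ-+ c (f d) _))

  sumℚ-fromℤ : ∀ (f : ℕ → ℤ) L → sumℚ (map (λ d → fromℤ (f d)) L) ≡ fromℤ (sumℤ (map f L))
  sumℚ-fromℤ f []      = refl
  sumℚ-fromℤ f (d ∷ L) = trans (cong (_+_ (fromℤ (f d))) (sumℚ-fromℤ f L)) (sym (fromℤ-+ (f d) (sumℤ (map f L))))

  sumℚ-linear : ∀ α β (f : ℕ → ℤ) (g : ℕ → ℚ) L →
                sumℚ (map (λ d → α * fromℤ (f d) + β * g d) L) ≡ α * fromℤ (sumℤ (map f L)) + β * sumℚ (map g L)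
  sumℚ-linear α β f g L = trans (sumℚ-+ (λ d → α * fromℤ (f d)) (λ d → β * g d) L)
    (cong₂ _+_ (trans (sumℚ-*ˡ α (λ d → fromℤ (f d)) L) (cong (α *_) (sumℚ-fromℤ f L))) (sumℚ-*ˡ β g L))

  divisors-∣ : ∀ N → All (ℕD._∣ N) (divisors N)
  divisors-∣ N = all-filter (_∣? N) (map suc (upTo N))

  -- N / d; the value at d = 0 is never used, as 0 is not a divisor of N ≠ 0
  cofactor : ℕ → ℕ → ℕ
  cofactor N zero    = 0
  cofactor N (suc d) = N ℕ./ suc d

  cofactor-nonZero : ∀ N d .{{_ : NonZero N}} → d ℕD.∣ N → NonZero (cofactor N d)
  cofactor-nonZero N zero    (divides q N≡q*0) = contradiction (trans N≡q*0 (ℕP.*-zeroʳ q)) (ℕ.≢-nonZero⁻¹ N)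
  cofactor-nonZero N (suc d) d∣N = ℕ.≢-nonZero λ N/d≡0 → ℕ.≢-nonZero⁻¹ N (trans (sym (m/n*n≡m d∣N)) (cong (ℕ._* suc d) N/d≡0))

  cofactor-* : ∀ N d .{{_ : NonZero N}} → d ℕD.∣ N → N ≡ cofactor N d ℕ.* d
  cofactor-* N zero    (divides q N≡q*0) = contradiction (trans N≡q*0 (ℕP.*-zeroʳ q)) (ℕ.≢-nonZero⁻¹ N)
  cofactor-* N (suc d) d∣N = sym (m/n*n≡m d∣N)

  -- (a, b; c N, δ) conjugated by diag(d, 1), where N = e d
  conjugate : (d e : ℕ) → ℤ → ℤ → ℤ → ℤ → Mat
  conjugate d e a b c δ = mat a (+ d ℤ.* b) (c ℤ.* + e) δ

  +N≡e*d : ∀ N e d → N ≡ e ℕ.* d → + N ≡ + e ℤ.* + d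
  +N≡e*d N e d N≡ed = trans (cong +_ N≡ed) (ℤP.pos-* e d)

  det-conjugate : ∀ N d e a b c δ → N ≡ e ℕ.* d → a ℤ.* δ ℤ.- b ℤ.* (c ℤ.* + N) ≡ + 1 → det (conjugate d e a b c δ) ≡ + 1
  det-conjugate N d e a b c δ N≡ed det≡1 =
    trans (regroup a b c δ (+ e) (+ d)) (trans (cong (λ x → a ℤ.* δ ℤ.- b ℤ.* (c ℤ.* x)) (sym (+N≡e*d N e d N≡ed))) det≡1)
    where
    regroup : ∀ a b c δ e d → a ℤ.* δ ℤ.- d ℤ.* b ℤ.* (c ℤ.* e) ≡ a ℤ.* δ ℤ.- b ℤ.* (c ℤ.* (e ℤ.* d))
    regroup = solve-∀

  conjugate-⊗ : ∀ N d e a b c δ a′ b′ c′ δ′ → N ≡ e ℕ.* d →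
    conjugate d e (a ℤ.* a′ ℤ.+ b ℤ.* (c′ ℤ.* + N)) (a ℤ.* b′ ℤ.+ b ℤ.* δ′) (c ℤ.* a′ ℤ.+ δ ℤ.* c′) (c ℤ.* + N ℤ.* b′ ℤ.+ δ ℤ.* δ′)
    ≡ conjugate d e a b c δ ⊗ conjugate d e a′ b′ c′ δ′
  conjugate-⊗ N d e a b c δ a′ b′ c′ δ′ N≡ed = mat-≡
    (trans (cong (λ x → a ℤ.* a′ ℤ.+ b ℤ.* (c′ ℤ.* x)) (+N≡e*d N e d N≡ed)) (top-left a a′ b c′ (+ e) (+ d)))
    (top-right a b b′ δ′ (+ d))
    (bottom-left c a′ δ c′ (+ e))
    (trans (cong (λ x → c ℤ.* x ℤ.* b′ ℤ.+ δ ℤ.* δ′) (+N≡e*d N e d N≡ed)) (bottom-right c b′ δ δ′ (+ e) (+ d)))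
    where
    top-left : ∀ a a′ b c′ e d → a ℤ.* a′ ℤ.+ b ℤ.* (c′ ℤ.* (e ℤ.* d)) ≡ a ℤ.* a′ ℤ.+ d ℤ.* b ℤ.* (c′ ℤ.* e)
    top-left = solve-∀
    top-right : ∀ a b b′ δ′ d → d ℤ.* (a ℤ.* b′ ℤ.+ b ℤ.* δ′) ≡ a ℤ.* (d ℤ.* b′) ℤ.+ d ℤ.* b ℤ.* δ′
    top-right = solve-∀
    bottom-left : ∀ c a′ δ c′ e → (c ℤ.* a′ ℤ.+ δ ℤ.* c′) ℤ.* e ≡ c ℤ.* e ℤ.* a′ ℤ.+ δ ℤ.* (c′ ℤ.* e)
    bottom-left = solve-∀
    bottom-right : ∀ c b′ δ δ′ e d → c ℤ.* (e ℤ.* d) ℤ.* b′ ℤ.+ δ ℤ.* δ′ ≡ c ℤ.* e ℤ.* (d ℤ.* b′) ℤ.+ δ ℤ.* δ′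
    bottom-right = solve-∀

  coprime-∣ : ∀ {x y k} → Coprime x y → k ℕD.∣ y → Coprime x k
  coprime-∣ x⊥y k∣y (i∣x , i∣k) = x⊥y (i∣x , ℕD.∣-trans i∣k k∣y)

  n·Φ-conjugate-zero : ∀ (n : ℕ → ℤ) d e a b δ →
                       fromℤ (n d) * Φ (conjugate d e a b (+ 0) δ) ≡ fromℤ (b ℤ.* δ) * fromℤ (n d ℤ.* + d)
  n·Φ-conjugate-zero n d e a b δ = begin
    fromℤ (n d) * fromℤ (+ d ℤ.* b ℤ.* δ)      ≡⟨ fromℤ-* (n d) (+ d ℤ.* b ℤ.* δ) ⟨
    fromℤ (n d ℤ.* (+ d ℤ.* b ℤ.* δ))          ≡⟨ cong fromℤ (regroup (n d) (+ d) b δ) ⟩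
    fromℤ (b ℤ.* δ ℤ.* (n d ℤ.* + d))          ≡⟨ fromℤ-* (b ℤ.* δ) (n d ℤ.* + d) ⟩
    fromℤ (b ℤ.* δ) * fromℤ (n d ℤ.* + d)      ∎
    where
    open ≡-Reasoning
    regroup : ∀ x d b δ → x ℤ.* (d ℤ.* b ℤ.* δ) ≡ b ℤ.* δ ℤ.* (x ℤ.* d)
    regroup = solve-∀

  rescaling : ∀ N′ m₀ d e′ → suc N′ ≡ suc e′ ℕ.* d → ∀ a → Coprime ∣ a ∣ (suc m₀ ℕ.* suc N′) →
              1/ℕ (suc m₀ ℕ.* suc e′) ≡ fromℤ (+ d) * 1/ℕ (suc m₀ ℕ.* suc N′)
              × s a (suc m₀ ℕ.* suc e′) ≡ D ((+ d ℚ./ 1) * (a ℚ./ (suc m₀ ℕ.* suc N′)))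
  rescaling N′ m₀ d e′ N≡ed a a⊥M =
    1/ℕ-cofactor K d M M≡Kd , sym (D-rescaled a K d M M≡Kd (coprime-∣ a⊥M (divides d (trans M≡Kd (ℕP.*-comm K d)))))
    where
    K = suc m₀ ℕ.* suc e′
    M = suc m₀ ℕ.* suc N′
    M≡Kd : M ≡ K ℕ.* d
    M≡Kd = trans (cong (suc m₀ ℕ.*_) N≡ed) (sym (ℕP.*-assoc (suc m₀) (suc e′) d))

  n·Φ-conjugate-pos : ∀ (n : ℕ → ℤ) N′ m₀ d e .{{_ : NonZero e}} → suc N′ ≡ e ℕ.* d → ∀ a b δ →
    a ℤ.* δ ℤ.- b ℤ.* (+[1+ m₀ ] ℤ.* + suc N′) ≡ + 1 →
    fromℤ (n d) * Φ (conjugate d e a b +[1+ m₀ ] δ)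
    ≡ fromℤ (a ℤ.+ δ) * 1/ℕ (suc m₀ ℕ.* suc N′) * fromℤ (n d ℤ.* + d)
      + - fromℤ (+ 12) * (fromℤ (n d) * D ((+ d ℚ./ 1) * (a ℚ./ (suc m₀ ℕ.* suc N′))))
  n·Φ-conjugate-pos n N′ m₀ d (suc e′) N≡ed a b δ det≡1 = begin
    fromℤ (n d) * (fromℤ (a ℤ.+ δ) * 1/ℕ (suc m₀ ℕ.* suc e′) - fromℤ (+ 12) * s a (suc m₀ ℕ.* suc e′))
      ≡⟨ cong₂ (λ i σ → fromℤ (n d) * (fromℤ (a ℤ.+ δ) * i - fromℤ (+ 12) * σ)) 1/K≡ s≡ ⟩
    fromℤ (n d) * (fromℤ (a ℤ.+ δ) * (fromℤ (+ d) * 1/ℕ M) - fromℤ (+ 12) * D x)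
      ≡⟨ distribute (fromℤ (n d)) (fromℤ (a ℤ.+ δ)) (fromℤ (+ d)) (1/ℕ M) (fromℤ (+ 12)) (D x) ⟩
    fromℤ (a ℤ.+ δ) * 1/ℕ M * (fromℤ (n d) * fromℤ (+ d)) + - fromℤ (+ 12) * (fromℤ (n d) * D x)
      ≡⟨ cong (λ y → fromℤ (a ℤ.+ δ) * 1/ℕ M * y + - fromℤ (+ 12) * (fromℤ (n d) * D x)) (fromℤ-* (n d) (+ d)) ⟨
    fromℤ (a ℤ.+ δ) * 1/ℕ M * fromℤ (n d ℤ.* + d) + - fromℤ (+ 12) * (fromℤ (n d) * D x) ∎
    where
    open ≡-Reasoning
    M = suc m₀ ℕ.* suc N′
    x = (+ d ℚ./ 1) * (a ℚ./ M)
    1/K≡ = proj₁ (rescaling N′ m₀ d e′ N≡ed a (det⇒coprime a b (+[1+ m₀ ] ℤ.* + suc N′) δ det≡1))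
    s≡ = proj₂ (rescaling N′ m₀ d e′ N≡ed a (det⇒coprime a b (+[1+ m₀ ] ℤ.* + suc N′) δ det≡1))
    distribute : ∀ ν X c i t σ → ν * (X * (c * i) - t * σ) ≡ X * i * (ν * c) + - t * (ν * σ)
    distribute = RingSolver.solve-∀ ℚ-ring

  n·Φ-conjugate-neg : ∀ (n : ℕ → ℤ) N′ m₀ d e .{{_ : NonZero e}} → suc N′ ≡ e ℕ.* d → ∀ a b δ →
    a ℤ.* δ ℤ.- b ℤ.* (-[1+ m₀ ] ℤ.* + suc N′) ≡ + 1 →
    fromℤ (n d) * Φ (conjugate d e a b -[1+ m₀ ] δ)
    ≡ - (fromℤ (a ℤ.+ δ) * 1/ℕ (suc m₀ ℕ.* suc N′)) * fromℤ (n d ℤ.* + d)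
      + fromℤ (+ 12) * (fromℤ (n d) * D ((+ d ℚ./ 1) * (a ℚ./ (suc m₀ ℕ.* suc N′))))
  n·Φ-conjugate-neg n N′ m₀ d (suc e′) N≡ed a b δ det≡1 = begin
    fromℤ (n d) * (- (fromℤ (a ℤ.+ δ) * 1/ℕ (suc m₀ ℕ.* suc e′)) + fromℤ (+ 12) * s a (suc m₀ ℕ.* suc e′))
      ≡⟨ cong₂ (λ i σ → fromℤ (n d) * (- (fromℤ (a ℤ.+ δ) * i) + fromℤ (+ 12) * σ)) 1/K≡ s≡ ⟩
    fromℤ (n d) * (- (fromℤ (a ℤ.+ δ) * (fromℤ (+ d) * 1/ℕ M)) + fromℤ (+ 12) * D x)
      ≡⟨ distribute (fromℤ (n d)) (fromℤ (a ℤ.+ δ)) (fromℤ (+ d)) (1/ℕ M) (fromℤ (+ 12)) (D x) ⟩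
    - (fromℤ (a ℤ.+ δ) * 1/ℕ M) * (fromℤ (n d) * fromℤ (+ d)) + fromℤ (+ 12) * (fromℤ (n d) * D x)
      ≡⟨ cong (λ y → - (fromℤ (a ℤ.+ δ) * 1/ℕ M) * y + fromℤ (+ 12) * (fromℤ (n d) * D x)) (fromℤ-* (n d) (+ d)) ⟨
    - (fromℤ (a ℤ.+ δ) * 1/ℕ M) * fromℤ (n d ℤ.* + d) + fromℤ (+ 12) * (fromℤ (n d) * D x) ∎
    where
    open ≡-Reasoning
    M = suc m₀ ℕ.* suc N′
    x = (+ d ℚ./ 1) * (a ℚ./ M)
    1/K≡ = proj₁ (rescaling N′ m₀ d e′ N≡ed a (det⇒coprime a b (-[1+ m₀ ] ℤ.* + suc N′) δ det≡1))
    s≡ = proj₂ (rescaling N′ m₀ d e′ N≡ed a (det⇒coprime a b (-[1+ m₀ ] ℤ.* + suc N′) δ det≡1))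
    distribute : ∀ ν X c i t σ → ν * (- (X * (c * i)) + t * σ) ≡ - (X * i) * (ν * c) + t * (ν * σ)
    distribute = RingSolver.solve-∀ ℚ-ring

  Ψ-as-Φ-sum : ∀ N .{{_ : NonZero N}} (n : ℕ → ℤ) → sumℤ (map (λ d → n d ℤ.* + d) (divisors N)) ≡ + 0 →
               ∀ a b c δ → a ℤ.* δ ℤ.- b ℤ.* (c ℤ.* + N) ≡ + 1 →
               sumℚ (map (λ d → fromℤ (n d) * Φ (conjugate d (cofactor N d) a b c δ)) (divisors N))
               ≡ - (fromℤ (+ 12) * Ψ N n (mat a b (c ℤ.* + N) δ))
  Ψ-as-Φ-sum N@(suc N′) n Σnd≡0 a b (+ zero) δ _ = begin
    sumℚ (map (λ d → fromℤ (n d) * Φ (conjugate d (cofactor N d) a b (+ 0) δ)) (divisors N))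
      ≡⟨ sumℚ-cong (divisors N) (divisors-∣ N) (λ {d} _ → n·Φ-conjugate-zero n d (cofactor N d) a b δ) ⟩
    sumℚ (map (λ d → fromℤ (b ℤ.* δ) * fromℤ (n d ℤ.* + d)) (divisors N))
      ≡⟨ sumℚ-*ˡ (fromℤ (b ℤ.* δ)) (λ d → fromℤ (n d ℤ.* + d)) (divisors N) ⟩
    fromℤ (b ℤ.* δ) * sumℚ (map (λ d → fromℤ (n d ℤ.* + d)) (divisors N))
      ≡⟨ cong (fromℤ (b ℤ.* δ) *_) (trans (sumℚ-fromℤ (λ d → n d ℤ.* + d) (divisors N)) (cong fromℤ Σnd≡0)) ⟩
    fromℤ (b ℤ.* δ) * 0ℚ
      ≡⟨ algebra (fromℤ (b ℤ.* δ)) ⟩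
    - (fromℤ (+ 12) * 0ℚ) ∎
    where
    open ≡-Reasoning
    algebra : ∀ x → x * 0ℚ ≡ - (fromℤ (+ 12) * 0ℚ)
    algebra = RingSolver.solve-∀ ℚ-ring
  Ψ-as-Φ-sum N@(suc N′) n Σnd≡0 a b +[1+ m₀ ] δ det≡1 = begin
    sumℚ (map (λ d → fromℤ (n d) * Φ (conjugate d (cofactor N d) a b +[1+ m₀ ] δ)) (divisors N))
      ≡⟨ sumℚ-cong (divisors N) (divisors-∣ N) (λ {d} d∣N →
           n·Φ-conjugate-pos n N′ m₀ d (cofactor N d) {{cofactor-nonZero N d d∣N}} (cofactor-* N d d∣N) a b δ det≡1) ⟩
    sumℚ (map (λ d → X * fromℤ (n d ℤ.* + d) + - fromℤ (+ 12) * (fromℤ (n d) * D ((+ d ℚ./ 1) * x))) (divisors N))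
      ≡⟨ sumℚ-linear X (- fromℤ (+ 12)) (λ d → n d ℤ.* + d) (λ d → fromℤ (n d) * D ((+ d ℚ./ 1) * x)) (divisors N) ⟩
    X * fromℤ (sumℤ (map (λ d → n d ℤ.* + d) (divisors N))) + - fromℤ (+ 12) * Dδ N n x
      ≡⟨ cong (λ y → X * fromℤ y + - fromℤ (+ 12) * Dδ N n x) Σnd≡0 ⟩
    X * 0ℚ + - fromℤ (+ 12) * Dδ N n x
      ≡⟨ algebra X (Dδ N n x) ⟩
    - (fromℤ (+ 12) * Dδ N n x) ∎
    where
    open ≡-Reasoning
    M = suc m₀ ℕ.* N
    x = a ℚ./ M
    X = fromℤ (a ℤ.+ δ) * 1/ℕ M
    algebra : ∀ X D → X * 0ℚ + - fromℤ (+ 12) * D ≡ - (fromℤ (+ 12) * D)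
    algebra = RingSolver.solve-∀ ℚ-ring
  Ψ-as-Φ-sum N@(suc N′) n Σnd≡0 a b -[1+ m₀ ] δ det≡1 = begin
    sumℚ (map (λ d → fromℤ (n d) * Φ (conjugate d (cofactor N d) a b -[1+ m₀ ] δ)) (divisors N))
      ≡⟨ sumℚ-cong (divisors N) (divisors-∣ N) (λ {d} d∣N →
           n·Φ-conjugate-neg n N′ m₀ d (cofactor N d) {{cofactor-nonZero N d d∣N}} (cofactor-* N d d∣N) a b δ det≡1) ⟩
    sumℚ (map (λ d → - X * fromℤ (n d ℤ.* + d) + fromℤ (+ 12) * (fromℤ (n d) * D ((+ d ℚ./ 1) * x))) (divisors N))
      ≡⟨ sumℚ-linear (- X) (fromℤ (+ 12)) (λ d → n d ℤ.* + d) (λ d → fromℤ (n d) * D ((+ d ℚ./ 1) * x)) (divisors N) ⟩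
    - X * fromℤ (sumℤ (map (λ d → n d ℤ.* + d) (divisors N))) + fromℤ (+ 12) * Dδ N n x
      ≡⟨ cong (λ y → - X * fromℤ y + fromℤ (+ 12) * Dδ N n x) Σnd≡0 ⟩
    - X * 0ℚ + fromℤ (+ 12) * Dδ N n x
      ≡⟨ algebra X (Dδ N n x) ⟩
    - (fromℤ (+ 12) * - Dδ N n x) ∎
    where
    open ≡-Reasoning
    M = suc m₀ ℕ.* N
    x = a ℚ./ M
    X = fromℤ (a ℤ.+ δ) * 1/ℕ M
    algebra : ∀ X D → - X * 0ℚ + fromℤ (+ 12) * D ≡ - (fromℤ (+ 12) * - D)
    algebra = RingSolver.solve-∀ ℚ-ring

  ε-conjugate : ∀ d e .{{_ : NonZero e}} a b c δ a′ b′ c′ δ′ →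
                sign-correction (conjugate d e a b c δ) (conjugate d e a′ b′ c′ δ′)
                ≡ + 3 ℤ.* sgn c ℤ.* sgn c′ ℤ.* sgn (c ℤ.* a′ ℤ.+ δ ℤ.* c′)
  ε-conjugate d e@(suc e′) a b c δ a′ b′ c′ δ′ = begin
    + 3 ℤ.* sgn (c ℤ.* + e) ℤ.* sgn (c′ ℤ.* + e) ℤ.* sgn (c ℤ.* + e ℤ.* a′ ℤ.+ δ ℤ.* (c′ ℤ.* + e))
      ≡⟨ cong (λ x → + 3 ℤ.* sgn (c ℤ.* + e) ℤ.* sgn (c′ ℤ.* + e) ℤ.* sgn x) (factor c a′ δ c′ (+ e)) ⟩
    + 3 ℤ.* sgn (c ℤ.* + e) ℤ.* sgn (c′ ℤ.* + e) ℤ.* sgn ((c ℤ.* a′ ℤ.+ δ ℤ.* c′) ℤ.* + e)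
      ≡⟨ cong₂ (λ x y → + 3 ℤ.* x ℤ.* y ℤ.* sgn ((c ℤ.* a′ ℤ.+ δ ℤ.* c′) ℤ.* + e)) (sgn-*-pos c e′) (sgn-*-pos c′ e′) ⟩
    + 3 ℤ.* sgn c ℤ.* sgn c′ ℤ.* sgn ((c ℤ.* a′ ℤ.+ δ ℤ.* c′) ℤ.* + e)
      ≡⟨ cong (λ x → + 3 ℤ.* sgn c ℤ.* sgn c′ ℤ.* x) (sgn-*-pos (c ℤ.* a′ ℤ.+ δ ℤ.* c′) e′) ⟩
    + 3 ℤ.* sgn c ℤ.* sgn c′ ℤ.* sgn (c ℤ.* a′ ℤ.+ δ ℤ.* c′) ∎
    where
    open ≡-Reasoning
    factor : ∀ c a′ δ c′ e → c ℤ.* e ℤ.* a′ ℤ.+ δ ℤ.* (c′ ℤ.* e) ≡ (c ℤ.* a′ ℤ.+ δ ℤ.* c′) ℤ.* e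
    factor = solve-∀

  n·Φ-conjugate-⊗ : ∀ (n : ℕ → ℤ) N d e .{{_ : NonZero e}} → N ≡ e ℕ.* d → ∀ a b c δ a′ b′ c′ δ′ →
    a ℤ.* δ ℤ.- b ℤ.* (c ℤ.* + N) ≡ + 1 → a′ ℤ.* δ′ ℤ.- b′ ℤ.* (c′ ℤ.* + N) ≡ + 1 →
    fromℤ (n d) * Φ (conjugate d e (a ℤ.* a′ ℤ.+ b ℤ.* (c′ ℤ.* + N)) (a ℤ.* b′ ℤ.+ b ℤ.* δ′)
                                   (c ℤ.* a′ ℤ.+ δ ℤ.* c′) (c ℤ.* + N ℤ.* b′ ℤ.+ δ ℤ.* δ′))
    ≡ fromℤ (n d) * Φ (conjugate d e a b c δ) + fromℤ (n d) * Φ (conjugate d e a′ b′ c′ δ′)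
      + - fromℤ (+ 3 ℤ.* sgn c ℤ.* sgn c′ ℤ.* sgn (c ℤ.* a′ ℤ.+ δ ℤ.* c′)) * fromℤ (n d)
  n·Φ-conjugate-⊗ n N d e N≡ed a b c δ a′ b′ c′ δ′ det≡1 det′≡1 = begin
    fromℤ (n d) * Φ (conjugate d e (a ℤ.* a′ ℤ.+ b ℤ.* (c′ ℤ.* + N)) (a ℤ.* b′ ℤ.+ b ℤ.* δ′)
                                   (c ℤ.* a′ ℤ.+ δ ℤ.* c′) (c ℤ.* + N ℤ.* b′ ℤ.+ δ ℤ.* δ′))
      ≡⟨ cong (λ M → fromℤ (n d) * Φ M) (conjugate-⊗ N d e a b c δ a′ b′ c′ δ′ N≡ed) ⟩
    fromℤ (n d) * Φ (g ⊗ h)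
      ≡⟨ cong (fromℤ (n d) *_) (Φ-cocycle g h (det-conjugate N d e a b c δ N≡ed det≡1)
                                              (det-conjugate N d e a′ b′ c′ δ′ N≡ed det′≡1)) ⟩
    fromℤ (n d) * (Φ g + Φ h - fromℤ (sign-correction g h))
      ≡⟨ cong (λ σ → fromℤ (n d) * (Φ g + Φ h - fromℤ σ)) (ε-conjugate d e a b c δ a′ b′ c′ δ′) ⟩
    fromℤ (n d) * (Φ g + Φ h - fromℤ σ)
      ≡⟨ distribute (fromℤ (n d)) (Φ g) (Φ h) (fromℤ σ) ⟩
    fromℤ (n d) * Φ g + fromℤ (n d) * Φ h + - fromℤ σ * fromℤ (n d) ∎
    where
    open ≡-Reasoning
    g = conjugate d e a b c δ
    h = conjugate d e a′ b′ c′ δ′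
    σ = + 3 ℤ.* sgn c ℤ.* sgn c′ ℤ.* sgn (c ℤ.* a′ ℤ.+ δ ℤ.* c′)
    distribute : ∀ ν φ φ′ σ → ν * (φ + φ′ - σ) ≡ ν * φ + ν * φ′ + - σ * ν
    distribute = RingSolver.solve-∀ ℚ-ring

  Ψ-additive-scaled : ∀ N .{{_ : NonZero N}} (n : ℕ → ℤ) →
    sumℤ (map n (divisors N)) ≡ + 0 → sumℤ (map (λ d → n d ℤ.* + d) (divisors N)) ≡ + 0 →
    ∀ a b c δ a′ b′ c′ δ′ → a ℤ.* δ ℤ.- b ℤ.* (c ℤ.* + N) ≡ + 1 → a′ ℤ.* δ′ ℤ.- b′ ℤ.* (c′ ℤ.* + N) ≡ + 1 →
    - (fromℤ (+ 12) * Ψ N n (mat a b (c ℤ.* + N) δ ⊗ mat a′ b′ (c′ ℤ.* + N) δ′))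
    ≡ - (fromℤ (+ 12) * Ψ N n (mat a b (c ℤ.* + N) δ)) + - (fromℤ (+ 12) * Ψ N n (mat a′ b′ (c′ ℤ.* + N) δ′))
  Ψ-additive-scaled N n Σn≡0 Σnd≡0 a b c δ a′ b′ c′ δ′ det≡1 det′≡1 = begin
    - (fromℤ (+ 12) * Ψ N n (g ⊗ h))
      ≡⟨ cong (λ M → - (fromℤ (+ 12) * Ψ N n M)) g⊗h≡ ⟩
    - (fromℤ (+ 12) * Ψ N n (mat A B (c″ ℤ.* + N) Δ))
      ≡⟨ Ψ-as-Φ-sum N n Σnd≡0 A B c″ Δ det-g⊗h ⟨
    sumℚ (map (nΦ (λ d → conjugate d (cofactor N d) A B c″ Δ)) L)
      ≡⟨ sumℚ-cong L (divisors-∣ N) (λ {d} d∣N → n·Φ-conjugate-⊗ n N d (cofactor N d) {{cofactor-nonZero N d d∣N}}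
          (cofactor-* N d d∣N) a b c δ a′ b′ c′ δ′ det≡1 det′≡1) ⟩
    sumℚ (map (λ d → nΦ g′ d + nΦ h′ d + - fromℤ σ * fromℤ (n d)) L)
      ≡⟨ sumℚ-+ (λ d → nΦ g′ d + nΦ h′ d) (λ d → - fromℤ σ * fromℤ (n d)) L ⟩
    sumℚ (map (λ d → nΦ g′ d + nΦ h′ d) L) + sumℚ (map (λ d → - fromℤ σ * fromℤ (n d)) L)
      ≡⟨ cong₂ _+_ (sumℚ-+ (nΦ g′) (nΦ h′) L)
                   (trans (sumℚ-*ˡ (- fromℤ σ) (λ d → fromℤ (n d)) L) (cong (- fromℤ σ *_) (sumℚ-fromℤ n L))) ⟩
    sumℚ (map (nΦ g′) L) + sumℚ (map (nΦ h′) L) + - fromℤ σ * fromℤ (sumℤ (map n L))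
      ≡⟨ cong₂ _+_ (cong₂ _+_ (Ψ-as-Φ-sum N n Σnd≡0 a b c δ det≡1) (Ψ-as-Φ-sum N n Σnd≡0 a′ b′ c′ δ′ det′≡1))
          (trans (cong (λ x → - fromℤ σ * fromℤ x) Σn≡0) (ℚP.*-zeroʳ (- fromℤ σ))) ⟩
    - (fromℤ (+ 12) * Ψ N n g) + - (fromℤ (+ 12) * Ψ N n h) + 0ℚ
      ≡⟨ ℚP.+-identityʳ (- (fromℤ (+ 12) * Ψ N n g) + - (fromℤ (+ 12) * Ψ N n h)) ⟩
    - (fromℤ (+ 12) * Ψ N n g) + - (fromℤ (+ 12) * Ψ N n h) ∎
    where
    open ≡-Reasoning
    L = divisors N
    g = mat a b (c ℤ.* + N) δ
    h = mat a′ b′ (c′ ℤ.* + N) δ′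
    A = a ℤ.* a′ ℤ.+ b ℤ.* (c′ ℤ.* + N)
    B = a ℤ.* b′ ℤ.+ b ℤ.* δ′
    c″ = c ℤ.* a′ ℤ.+ δ ℤ.* c′
    Δ = c ℤ.* + N ℤ.* b′ ℤ.+ δ ℤ.* δ′
    σ = + 3 ℤ.* sgn c ℤ.* sgn c′ ℤ.* sgn c″
    g′ h′ : ℕ → Mat
    g′ d = conjugate d (cofactor N d) a b c δ
    h′ d = conjugate d (cofactor N d) a′ b′ c′ δ′
    nΦ : (ℕ → Mat) → ℕ → ℚ
    nΦ M d = fromℤ (n d) * Φ (M d)
    g⊗h≡ : g ⊗ h ≡ mat A B (c″ ℤ.* + N) Δ
    g⊗h≡ = mat-≡ refl refl (factor c a′ δ c′ (+ N)) refl
      where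
      factor : ∀ c a′ δ c′ N → c ℤ.* N ℤ.* a′ ℤ.+ δ ℤ.* (c′ ℤ.* N) ≡ (c ℤ.* a′ ℤ.+ δ ℤ.* c′) ℤ.* N
      factor = solve-∀
    det-g⊗h : A ℤ.* Δ ℤ.- B ℤ.* (c″ ℤ.* + N) ≡ + 1
    det-g⊗h = trans (cong det (sym g⊗h≡)) (trans (det-⊗ g h) (cong₂ ℤ._*_ det≡1 det′≡1))

open DivisorSums using (Ψ-additive-scaled)
open RationalArithmetic using (cancel-negated-multiple)
open import Data.Nat using (ℕ; NonZero)
open import Data.Integer using (ℤ; +_; _*_)
open import Data.Integer.Divisibility.Signed using (divides; ∣ᵤ⇒∣)
open import Data.Rational using (_+_)
open import Data.List using (map)
open import Relation.Binary.PropositionalEquality using (_≡_; refl)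

mainTheorem2 : (N : ℕ) → .{{_ : NonZero N}} → (n : ℕ → ℤ) →
    sumℤ (map n (divisors N)) ≡ + 0 →
    sumℤ (map (λ d → n d * + d) (divisors N)) ≡ + 0 →
    (g h : Mat) → InΓ₀ N g → InΓ₀ N h →
    Ψ N n (g ⊗ h) ≡ Ψ N n g + Ψ N n h
mainTheorem2 N n Σn≡0 Σnd≡0 (mat a b c δ) (mat a′ b′ c′ δ′) g∈Γ₀ h∈Γ₀
  with ∣ᵤ⇒∣ {+ N} {c} (InΓ₀.level g∈Γ₀) | ∣ᵤ⇒∣ {+ N} {c′} (InΓ₀.level h∈Γ₀)
... | divides c₀ refl | divides c₀′ refl = cancel-negated-multiple 12 (Ψ N n (g ⊗ h)) (Ψ N n g) (Ψ N n h)
  (Ψ-additive-scaled N n Σn≡0 Σnd≡0 a b c₀ δ a′ b′ c₀′ δ′ (InΓ₀.det g∈Γ₀) (InΓ₀.det h∈Γ₀))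
  where
  g = mat a b (c₀ * + N) δ
  h = mat a′ b′ (c₀′ * + N) δ′
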